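{- For every positive integer $k$, the path $P_{4k+1}$ is not determined by its Hermitian spectrum (not DHS).
   Context: A mixed graph has undirected edges and directed edges (ordered pairs $(x,y)$). For vertices $v_1,\dots,v_n$, its Hermitian adjacency matrix $H(X)$ has $(j,k)$ entry $1$ if $v_jv_k$ is an undirected edge, $i$ if $(v_j,v_k)$ is a directed edge, $-i$ if $(v_k,v_j)$ is a directed edge, $0$ otherwise; $\mathrm{Spec}_H(X)$ is its multiset of eigenvalues. Mixed graphs $X,Y$ on the same vertex set are switching equivalent if $H(X)=D^{ -1}H(Y)D$ for a diagonal $D$ with diagonal entries in $\{\pm1,\pm i\}$. A mixed graph $X$ is DHS if every mixed graph $Y$ with $\mathrm{Spec}_H(Y)=\mathrm{Spec}_H(X)$ is switching equivalent to a mixed graph isomorphic to $X$. $P_n$ is the path on $n$ vertices with all edges undirected. -}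

module Defs where

open import Data.Nat as ℕ using (ℕ; zero; suc)
import Data.Nat.Properties as ℕP
open import Data.Integer as ℤ using (ℤ; +_; -[1+_])
open import Data.Fin using (Fin; zero; suc; toℕ; punchIn)
open import Data.List using (List; foldr; map)
open import Data.List.Base using (upTo)
open import Data.Product using (Σ; ∃; _×_; _,_)
open import Relation.Binary.PropositionalEquality using (_≡_; refl; sym)
open import Relation.Nullary using (yes; no; ¬_)
open import Function.Bundles using (_↔_; Inverse)

record ℤi : Set where
  constructor _+i_
  field
    re : ℤ
    im : ℤ

infixl 6 _⊕_ _⊖_
infixl 7 _⊗_

_⊕_ : ℤi → ℤi → ℤi
(a +i b) ⊕ (c +i d) = (a ℤ.+ c) +i (b ℤ.+ d)

⊝_ : ℤi → ℤi
⊝ (a +i b) = (ℤ.- a) +i (ℤ.- b)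

_⊖_ : ℤi → ℤi → ℤi
x ⊖ y = x ⊕ (⊝ y)

_⊗_ : ℤi → ℤi → ℤi
(a +i b) ⊗ (c +i d) = ((a ℤ.* c) ℤ.- (b ℤ.* d)) +i ((a ℤ.* d) ℤ.+ (b ℤ.* c))

𝟘 𝟙 𝕚 : ℤi
𝟘 = (+ 0) +i (+ 0)
𝟙 = (+ 1) +i (+ 0)
𝕚 = (+ 0) +i (+ 1)

-- For an ordered pair (v_j , v_k) the entry records:
--   none : no edge;  undir : undirected edge v_j v_k;
--   fwd  : directed edge (v_j , v_k);  bwd : directed edge (v_k , v_j).

data Entry : Set where
  none undir fwd bwd : Entry

rev : Entry → Entry
rev none  = none
rev undir = undir
rev fwd   = bwd
rev bwd   = fwd

record MixedGraph (n : ℕ) : Set where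
  field
    rel    : Fin n → Fin n → Entry
    loopless : ∀ a → rel a a ≡ none
    consistent : ∀ a b → rel b a ≡ rev (rel a b)
open MixedGraph public

entryH : Entry → ℤi
entryH none  = 𝟘
entryH undir = 𝟙
entryH fwd   = 𝕚
entryH bwd   = ⊝ 𝕚

Matrix : Set → ℕ → Set
Matrix A n = Fin n → Fin n → A

H : ∀ {n} → MixedGraph n → Matrix ℤi n
H X j k = entryH (rel X j k)

-- Polynomials over ℤ[i], as coefficient sequences (coefficient of x^m).

Poly : Set
Poly = ℕ → ℤi

sumList : List ℤi → ℤi
sumList = foldr _⊕_ 𝟘

_p+_ : Poly → Poly → Poly
(p p+ q) m = p m ⊕ q m

p-_ : Poly → Poly
(p- p) m = ⊝ p m

_p*_ : Poly → Poly → Poly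
(p p* q) m = sumList (map (λ j → p j ⊗ q (m ℕ.∸ j)) (upTo (suc m)))

const : ℤi → Poly
const c zero    = c
const c (suc _) = 𝟘

X : Poly
X zero          = 𝟘
X (suc zero)    = 𝟙
X (suc (suc _)) = 𝟘

psum : ∀ {n} → (Fin n → Poly) → Poly
psum {zero}  f = const 𝟘
psum {suc n} f = f zero p+ psum (λ j → f (suc j))

sign : ℕ → Poly → Poly
sign zero    p = p
sign (suc m) p = p- (sign m p)

det : ∀ {n} → Matrix Poly n → Poly
det {zero}  M = const 𝟙
det {suc n} M =
  psum (λ j → sign (toℕ j) (M zero j p* det (λ a b → M (suc a) (punchIn j b))))

charPoly : ∀ {n} → Matrix ℤi n → Poly
charPoly {n} A = det (λ a b → diag a b p+ (p- const (A a b)))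
  where
  diag : Fin n → Fin n → Poly
  diag a b with toℕ a ℕ.≟ toℕ b
  ... | yes _ = X
  ... | no  _ = const 𝟘

-- Equal H-spectra (multisets of eigenvalues) = equal characteristic
-- polynomials.
SameSpec : ∀ {n} → MixedGraph n → MixedGraph n → Set
SameSpec X₁ Y₁ = ∀ m → charPoly (H X₁) m ≡ charPoly (H Y₁) m

data Unit4 : Set where
  u1 u-1 ui u-i : Unit4

val : Unit4 → ℤi
val u1  = 𝟙
val u-1 = ⊝ 𝟙
val ui  = 𝕚
val u-i = ⊝ 𝕚

inv : Unit4 → Unit4
inv u1  = u1
inv u-1 = u-1
inv ui  = u-i
inv u-i = ui

SwitchingEquiv : ∀ {n} → MixedGraph n → MixedGraph n → Set
SwitchingEquiv {n} X₁ Y₁ =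
  Σ (Fin n → Unit4) λ D →
    ∀ j k → H X₁ j k ≡ (val (inv (D j)) ⊗ H Y₁ j k) ⊗ val (D k)

Isomorphic : ∀ {n} → MixedGraph n → MixedGraph n → Set
Isomorphic {n} X₁ Y₁ =
  Σ (Fin n ↔ Fin n) λ σ →
    ∀ a b → rel Y₁ (Inverse.to σ a) (Inverse.to σ b) ≡ rel X₁ a b

DHS : ∀ {n} → MixedGraph n → Set
DHS {n} X₁ =
  ∀ (Y₁ : MixedGraph n) → SameSpec Y₁ X₁ →
    Σ (MixedGraph n) λ Z → SwitchingEquiv Y₁ Z × Isomorphic Z X₁

pathRel : ∀ {n} → Fin n → Fin n → Entry
pathRel a b with toℕ b ℕ.≟ suc (toℕ a) | toℕ a ℕ.≟ suc (toℕ b)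
... | yes _ | _     = undir
... | no _  | yes _ = undir
... | no _  | no _  = none

pathLoopless : ∀ {n} (a : Fin n) → pathRel a a ≡ none
pathLoopless a with toℕ a ℕ.≟ suc (toℕ a)
... | yes p = Data.Empty.⊥-elim (ℕP.m≢1+n+m (toℕ a) {0} p)
  where import Data.Empty
... | no _ = refl

pathSym : ∀ {n} (a b : Fin n) → pathRel b a ≡ rev (pathRel a b)
pathSym a b with toℕ b ℕ.≟ suc (toℕ a) | toℕ a ℕ.≟ suc (toℕ b)
... | yes p | yes q = refl
... | yes p | no q  = refl
... | no p  | yes q = refl
... | no p  | no q  = refl

P : (n : ℕ) → MixedGraph n
P n = record { rel = pathRel ; loopless = pathLoopless ; consistent = pathSym }

{-# OPTIONS --safe #-}
module Submission where

-- Write U n for U_{n−1}(x/2) (Chebyshev polynomials of the second kind), so that the path Pₙ has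
-- characteristic polynomial U (n + 1).  For the cycle C on m + 3 vertices with one edge turned into an
-- arc, expansion along the first row gives U (m + 4) − U (m + 2) − (i + ī) = U (m + 4) − U (m + 2).
-- Hence P_{m+2} ⊔ C has characteristic polynomial U (m + 3) (U (m + 4) − U (m + 2)), which equals
-- U (2m + 6), that of P_{2m+5}, by U (a + b + 1) = U (a + 1) U (b + 1) − U a U b.  Switching does not
-- change which pairs are adjacent and P_{2m+5} is connected, so this disconnected cospectral mate is
-- not switching equivalent to a copy of the path; m = 2k − 2 gives P_{4k+1}.

open import Defs
open import Data.Product using (Σ; _,_; _×_; proj₁; proj₂)
open import Data.Empty using (⊥-elim)
open import Data.Fin using (Fin; zero; suc; toℕ; punchIn; punchOut; inject₁; fromℕ; _↑ʳ_)
import Data.Fin.Properties as Fin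
open import Function using (_∘_; _$_)
open import Relation.Nullary using (¬_; yes; no)
open import Relation.Binary.PropositionalEquality
  using (_≡_; _≢_; refl; sym; trans; cong; cong₂; subst; isEquivalence; module ≡-Reasoning)
open import Algebra.Bundles using (CommutativeRing)
open import Algebra.Structures using (IsCommutativeRing)

module GaussianIntegers where
  open import Data.Integer using (ℤ; +_; _+_; _*_; _-_; -_)
  open import Data.Integer.Properties using (+-assoc; +-identityˡ; +-identityʳ; +-inverseˡ; +-inverseʳ; +-comm)
  open import Data.Integer.Tactic.RingSolver using (solve-∀)

  private
    *-assoc-re : ∀ a b c d e f →
      (a * c - b * d) * e - (a * d + b * c) * f ≡ a * (c * e - d * f) - b * (c * f + d * e)
    *-assoc-re = solve-∀
    *-assoc-im : ∀ a b c d e f →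
      (a * c - b * d) * f + (a * d + b * c) * e ≡ a * (c * f + d * e) + b * (c * e - d * f)
    *-assoc-im = solve-∀
    *-identityˡ-re : ∀ a b → + 1 * a - + 0 * b ≡ a
    *-identityˡ-re = solve-∀
    *-identityˡ-im : ∀ a b → + 1 * b + + 0 * a ≡ b
    *-identityˡ-im = solve-∀
    *-identityʳ-re : ∀ a b → a * + 1 - b * + 0 ≡ a
    *-identityʳ-re = solve-∀
    *-identityʳ-im : ∀ a b → a * + 0 + b * + 1 ≡ b
    *-identityʳ-im = solve-∀
    *-distribˡ-re : ∀ a b c d e f → a * (c + e) - b * (d + f) ≡ (a * c - b * d) + (a * e - b * f)
    *-distribˡ-re = solve-∀
    *-distribˡ-im : ∀ a b c d e f → a * (d + f) + b * (c + e) ≡ (a * d + b * c) + (a * f + b * e)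
    *-distribˡ-im = solve-∀
    *-distribʳ-re : ∀ a b c d e f → (c + e) * a - (d + f) * b ≡ (c * a - d * b) + (e * a - f * b)
    *-distribʳ-re = solve-∀
    *-distribʳ-im : ∀ a b c d e f → (c + e) * b + (d + f) * a ≡ (c * b + d * a) + (e * b + f * a)
    *-distribʳ-im = solve-∀
    *-comm-re : ∀ a b c d → a * c - b * d ≡ c * a - d * b
    *-comm-re = solve-∀
    *-comm-im : ∀ a b c d → a * d + b * c ≡ c * b + d * a
    *-comm-im = solve-∀

    *-embed-re : ∀ a b → a * b - + 0 * + 0 ≡ a * b
    *-embed-re = solve-∀
    *-embed-im : ∀ a b → a * + 0 + + 0 * b ≡ + 0
    *-embed-im = solve-∀

  embed : ℤ → ℤi
  embed a = a +i (+ 0)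

  embed-* : ∀ a b → embed (a * b) ≡ embed a ⊗ embed b
  embed-* a b = sym (cong₂ _+i_ (*-embed-re a b) (*-embed-im a b))

  ℤi-commutativeRing : CommutativeRing _ _
  ℤi-commutativeRing = record
    { Carrier = ℤi ; _≈_ = _≡_ ; _+_ = _⊕_ ; _*_ = _⊗_ ; -_ = ⊝_ ; 0# = 𝟘 ; 1# = 𝟙
    ; isCommutativeRing = record
      { isRing = record
        { +-isAbelianGroup = record
          { isGroup = record
            { isMonoid = record
              { isSemigroup = record
                { isMagma = record { isEquivalence = isEquivalence ; ∙-cong = cong₂ _⊕_ }
                ; assoc = λ where
                    (a +i b) (c +i d) (e +i f) → cong₂ _+i_ (+-assoc a c e) (+-assoc b d f) }
              ; identity = (λ where (a +i b) → cong₂ _+i_ (+-identityˡ a) (+-identityˡ b))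
                         , (λ where (a +i b) → cong₂ _+i_ (+-identityʳ a) (+-identityʳ b)) }
            ; inverse = (λ where (a +i b) → cong₂ _+i_ (+-inverseˡ a) (+-inverseˡ b))
                      , (λ where (a +i b) → cong₂ _+i_ (+-inverseʳ a) (+-inverseʳ b))
            ; ⁻¹-cong = cong ⊝_ }
          ; comm = λ where (a +i b) (c +i d) → cong₂ _+i_ (+-comm a c) (+-comm b d) }
        ; *-cong = cong₂ _⊗_
        ; *-assoc = λ where
            (a +i b) (c +i d) (e +i f) → cong₂ _+i_ (*-assoc-re a b c d e f) (*-assoc-im a b c d e f)
        ; *-identity = (λ where (a +i b) → cong₂ _+i_ (*-identityˡ-re a b) (*-identityˡ-im a b))
                     , (λ where (a +i b) → cong₂ _+i_ (*-identityʳ-re a b) (*-identityʳ-im a b))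
        ; distrib = (λ where
                      (a +i b) (c +i d) (e +i f) →
                        cong₂ _+i_ (*-distribˡ-re a b c d e f) (*-distribˡ-im a b c d e f))
                  , (λ where
                      (a +i b) (c +i d) (e +i f) →
                        cong₂ _+i_ (*-distribʳ-re a b c d e f) (*-distribʳ-im a b c d e f)) }
      ; *-comm = λ where (a +i b) (c +i d) → cong₂ _+i_ (*-comm-re a b c d) (*-comm-im a b c d) } }

open GaussianIntegers using (embed; embed-*; ℤi-commutativeRing)

open import Data.Nat as ℕ using (ℕ; zero; suc; _∸_; _<ᵇ_)
import Data.Nat.Properties as ℕ

-- Coefficientwise equality; a record, so that unification can recover both sides.
infix 4 _≈_
record _≈_ (p q : Poly) : Set where
  constructor coeffwise
  field coeff : ∀ m → p m ≡ q m
open _≈_ public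

≈-refl : ∀ {p} → p ≈ p
≈-refl = coeffwise λ _ → refl

≈-reflexive : ∀ {p q} → p ≡ q → p ≈ q
≈-reflexive refl = ≈-refl

≈-sym : ∀ {p q} → p ≈ q → q ≈ p
≈-sym p≈q = coeffwise λ m → sym (coeff p≈q m)

≈-trans : ∀ {p q r} → p ≈ q → q ≈ r → p ≈ r
≈-trans p≈q q≈r = coeffwise λ m → trans (coeff p≈q m) (coeff q≈r m)

module PolynomialRing where
  open import Data.List using (map; upTo; applyUpTo)
  open import Data.List.Properties using (map-applyUpTo; map-cong)
  open import Algebra.Properties.CommutativeSemigroup using (interchange; x∙yz≈y∙xz)
  open CommutativeRing ℤi-commutativeRing hiding (_≈_; refl; sym; trans)
  open ≡-Reasoning

  tail : Poly → Poly
  tail p = p ∘ suc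

  p*-coeff-zero : ∀ p q → (p p* q) 0 ≡ p 0 ⊗ q 0
  p*-coeff-zero p q = +-identityʳ (p 0 ⊗ q 0)

  p*-coeff-sucˡ : ∀ p q m → (p p* q) (suc m) ≡ p 0 ⊗ q (suc m) ⊕ (tail p p* q) m
  p*-coeff-sucˡ p q m = cong (p 0 ⊗ q (suc m) ⊕_) (cong sumList (begin
      map g (applyUpTo suc (suc m))        ≡⟨ map-applyUpTo suc g (suc m) ⟩
      applyUpTo (g ∘ suc) (suc m)          ≡⟨ map-applyUpTo (λ j → j) (g ∘ suc) (suc m) ⟨
      map (g ∘ suc) (upTo (suc m))         ∎))
    where
    g : ℕ → ℤi
    g j = p j ⊗ q (suc m ∸ j)

  p*-cong : ∀ {p p′ q q′} → p ≈ p′ → q ≈ q′ → (p p* q) ≈ (p′ p* q′)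
  p*-cong p≈p′ q≈q′ = coeffwise λ m →
    cong sumList (map-cong (λ j → cong₂ _⊗_ (coeff p≈p′ j) (coeff q≈q′ (m ∸ j))) (upTo (suc m)))

  p*-zeroˡ : ∀ q m → ((λ _ → 𝟘) p* q) m ≡ 𝟘
  p*-zeroˡ q zero    = trans (p*-coeff-zero (λ _ → 𝟘) q) (zeroˡ (q 0))
  p*-zeroˡ q (suc m) = begin
    ((λ _ → 𝟘) p* q) (suc m)             ≡⟨ p*-coeff-sucˡ (λ _ → 𝟘) q m ⟩
    𝟘 ⊗ q (suc m) ⊕ ((λ _ → 𝟘) p* q) m  ≡⟨ cong₂ _⊕_ (zeroˡ (q (suc m))) (p*-zeroˡ q m) ⟩
    𝟘 ⊕ 𝟘                                ≡⟨ +-identityʳ 𝟘 ⟩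
    𝟘                                    ∎

  const-p* : ∀ c q m → (const c p* q) m ≡ c ⊗ q m
  const-p* c q zero    = p*-coeff-zero (const c) q
  const-p* c q (suc m) = begin
    (const c p* q) (suc m)                ≡⟨ p*-coeff-sucˡ (const c) q m ⟩
    c ⊗ q (suc m) ⊕ ((λ _ → 𝟘) p* q) m   ≡⟨ cong (c ⊗ q (suc m) ⊕_) (p*-zeroˡ q m) ⟩
    c ⊗ q (suc m) ⊕ 𝟘                     ≡⟨ +-identityʳ (c ⊗ q (suc m)) ⟩
    c ⊗ q (suc m)                         ∎

  p*-scaleˡ : ∀ c p q m → ((λ j → c ⊗ p j) p* q) m ≡ c ⊗ (p p* q) m
  p*-scaleˡ c p q zero = begin
    ((λ j → c ⊗ p j) p* q) 0  ≡⟨ p*-coeff-zero (λ j → c ⊗ p j) q ⟩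
    (c ⊗ p 0) ⊗ q 0           ≡⟨ *-assoc c (p 0) (q 0) ⟩
    c ⊗ (p 0 ⊗ q 0)           ≡⟨ cong (c ⊗_) (p*-coeff-zero p q) ⟨
    c ⊗ (p p* q) 0            ∎
  p*-scaleˡ c p q (suc m) = begin
    ((λ j → c ⊗ p j) p* q) (suc m)
      ≡⟨ p*-coeff-sucˡ (λ j → c ⊗ p j) q m ⟩
    (c ⊗ p 0) ⊗ q (suc m) ⊕ ((λ j → c ⊗ p (suc j)) p* q) m
      ≡⟨ cong₂ _⊕_ (*-assoc c (p 0) (q (suc m))) (p*-scaleˡ c (tail p) q m) ⟩
    c ⊗ (p 0 ⊗ q (suc m)) ⊕ c ⊗ (tail p p* q) m
      ≡⟨ distribˡ c _ _ ⟨
    c ⊗ (p 0 ⊗ q (suc m) ⊕ (tail p p* q) m)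
      ≡⟨ cong (c ⊗_) (p*-coeff-sucˡ p q m) ⟨
    c ⊗ (p p* q) (suc m)
      ∎

  p*-distribʳ : ∀ p p′ q m → ((p p+ p′) p* q) m ≡ (p p* q) m ⊕ (p′ p* q) m
  p*-distribʳ p p′ q zero = begin
    ((p p+ p′) p* q) 0         ≡⟨ p*-coeff-zero (p p+ p′) q ⟩
    (p 0 ⊕ p′ 0) ⊗ q 0         ≡⟨ distribʳ (q 0) (p 0) (p′ 0) ⟩
    p 0 ⊗ q 0 ⊕ p′ 0 ⊗ q 0     ≡⟨ cong₂ _⊕_ (p*-coeff-zero p q) (p*-coeff-zero p′ q) ⟨
    (p p* q) 0 ⊕ (p′ p* q) 0   ∎
  p*-distribʳ p p′ q (suc m) = begin
    ((p p+ p′) p* q) (suc m)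
      ≡⟨ p*-coeff-sucˡ (p p+ p′) q m ⟩
    (p 0 ⊕ p′ 0) ⊗ q (suc m) ⊕ ((tail p p+ tail p′) p* q) m
      ≡⟨ cong₂ _⊕_ (distribʳ (q (suc m)) (p 0) (p′ 0)) (p*-distribʳ (tail p) (tail p′) q m) ⟩
    (p 0 ⊗ q (suc m) ⊕ p′ 0 ⊗ q (suc m)) ⊕ ((tail p p* q) m ⊕ (tail p′ p* q) m)
      ≡⟨ interchange +-commutativeSemigroup (p 0 ⊗ q (suc m)) (p′ 0 ⊗ q (suc m)) _ _ ⟩
    (p 0 ⊗ q (suc m) ⊕ (tail p p* q) m) ⊕ (p′ 0 ⊗ q (suc m) ⊕ (tail p′ p* q) m)
      ≡⟨ cong₂ _⊕_ (p*-coeff-sucˡ p q m) (p*-coeff-sucˡ p′ q m) ⟨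
    (p p* q) (suc m) ⊕ (p′ p* q) (suc m)
      ∎

  p*-coeff-sucʳ : ∀ p q m → (p p* q) (suc m) ≡ q 0 ⊗ p (suc m) ⊕ (p p* tail q) m
  p*-coeff-sucʳ p q zero = begin
    (p p* q) 1                    ≡⟨ p*-coeff-sucˡ p q 0 ⟩
    p 0 ⊗ q 1 ⊕ (tail p p* q) 0   ≡⟨ cong (p 0 ⊗ q 1 ⊕_) (p*-coeff-zero (tail p) q) ⟩
    p 0 ⊗ q 1 ⊕ p 1 ⊗ q 0         ≡⟨ +-comm (p 0 ⊗ q 1) (p 1 ⊗ q 0) ⟩
    p 1 ⊗ q 0 ⊕ p 0 ⊗ q 1         ≡⟨ cong₂ _⊕_ (*-comm (q 0) (p 1)) (p*-coeff-zero p (tail q)) ⟨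
    q 0 ⊗ p 1 ⊕ (p p* tail q) 0   ∎
  p*-coeff-sucʳ p q (suc m) = begin
    (p p* q) (2 ℕ.+ m)
      ≡⟨ p*-coeff-sucˡ p q (suc m) ⟩
    p 0 ⊗ q (2 ℕ.+ m) ⊕ (tail p p* q) (suc m)
      ≡⟨ cong (p 0 ⊗ q (2 ℕ.+ m) ⊕_) (p*-coeff-sucʳ (tail p) q m) ⟩
    p 0 ⊗ q (2 ℕ.+ m) ⊕ (q 0 ⊗ p (2 ℕ.+ m) ⊕ (tail p p* tail q) m)
      ≡⟨ x∙yz≈y∙xz +-commutativeSemigroup (p 0 ⊗ q (2 ℕ.+ m)) (q 0 ⊗ p (2 ℕ.+ m)) _ ⟩
    q 0 ⊗ p (2 ℕ.+ m) ⊕ (p 0 ⊗ q (2 ℕ.+ m) ⊕ (tail p p* tail q) m)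
      ≡⟨ cong (q 0 ⊗ p (2 ℕ.+ m) ⊕_) (p*-coeff-sucˡ p (tail q) m) ⟨
    q 0 ⊗ p (2 ℕ.+ m) ⊕ (p p* tail q) (suc m)
      ∎

  p*-comm : ∀ p q m → (p p* q) m ≡ (q p* p) m
  p*-comm p q zero = begin
    (p p* q) 0   ≡⟨ p*-coeff-zero p q ⟩
    p 0 ⊗ q 0    ≡⟨ *-comm (p 0) (q 0) ⟩
    q 0 ⊗ p 0    ≡⟨ p*-coeff-zero q p ⟨
    (q p* p) 0   ∎
  p*-comm p q (suc m) = begin
    (p p* q) (suc m)                     ≡⟨ p*-coeff-sucʳ p q m ⟩
    q 0 ⊗ p (suc m) ⊕ (p p* tail q) m    ≡⟨ cong (q 0 ⊗ p (suc m) ⊕_) (p*-comm p (tail q) m) ⟩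
    q 0 ⊗ p (suc m) ⊕ (tail q p* p) m    ≡⟨ p*-coeff-sucˡ q p m ⟨
    (q p* p) (suc m)                     ∎

  p*-assoc : ∀ p q r m → ((p p* q) p* r) m ≡ (p p* (q p* r)) m
  p*-assoc p q r zero = begin
    ((p p* q) p* r) 0       ≡⟨ p*-coeff-zero (p p* q) r ⟩
    (p p* q) 0 ⊗ r 0        ≡⟨ cong (_⊗ r 0) (p*-coeff-zero p q) ⟩
    (p 0 ⊗ q 0) ⊗ r 0       ≡⟨ *-assoc (p 0) (q 0) (r 0) ⟩
    p 0 ⊗ (q 0 ⊗ r 0)       ≡⟨ cong (p 0 ⊗_) (p*-coeff-zero q r) ⟨
    p 0 ⊗ (q p* r) 0        ≡⟨ p*-coeff-zero p (q p* r) ⟨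
    (p p* (q p* r)) 0       ∎
  p*-assoc p q r (suc m) = begin
    ((p p* q) p* r) (suc m)
      ≡⟨ p*-coeff-sucˡ (p p* q) r m ⟩
    (p p* q) 0 ⊗ r (suc m) ⊕ (tail (p p* q) p* r) m
      ≡⟨ cong₂ _⊕_ (cong (_⊗ r (suc m)) (p*-coeff-zero p q)) (coeff (p*-cong tail-p*-split (≈-refl {r})) m) ⟩
    (p 0 ⊗ q 0) ⊗ r (suc m) ⊕ (((λ j → p 0 ⊗ q (suc j)) p+ (tail p p* q)) p* r) m
      ≡⟨ cong ((p 0 ⊗ q 0) ⊗ r (suc m) ⊕_) (p*-distribʳ (λ j → p 0 ⊗ q (suc j)) (tail p p* q) r m) ⟩
    (p 0 ⊗ q 0) ⊗ r (suc m) ⊕ (((λ j → p 0 ⊗ q (suc j)) p* r) m ⊕ ((tail p p* q) p* r) m)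
      ≡⟨ cong₂ (λ a b → (p 0 ⊗ q 0) ⊗ r (suc m) ⊕ (a ⊕ b))
               (p*-scaleˡ (p 0) (tail q) r m) (p*-assoc (tail p) q r m) ⟩
    (p 0 ⊗ q 0) ⊗ r (suc m) ⊕ (p 0 ⊗ (tail q p* r) m ⊕ (tail p p* (q p* r)) m)
      ≡⟨ +-assoc ((p 0 ⊗ q 0) ⊗ r (suc m)) (p 0 ⊗ (tail q p* r) m) _ ⟨
    ((p 0 ⊗ q 0) ⊗ r (suc m) ⊕ p 0 ⊗ (tail q p* r) m) ⊕ (tail p p* (q p* r)) m
      ≡⟨ cong (_⊕ (tail p p* (q p* r)) m) (begin
           (p 0 ⊗ q 0) ⊗ r (suc m) ⊕ p 0 ⊗ (tail q p* r) m
             ≡⟨ cong (_⊕ p 0 ⊗ (tail q p* r) m) (*-assoc (p 0) (q 0) (r (suc m))) ⟩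
           p 0 ⊗ (q 0 ⊗ r (suc m)) ⊕ p 0 ⊗ (tail q p* r) m
             ≡⟨ distribˡ (p 0) _ _ ⟨
           p 0 ⊗ (q 0 ⊗ r (suc m) ⊕ (tail q p* r) m)
             ≡⟨ cong (p 0 ⊗_) (p*-coeff-sucˡ q r m) ⟨
           p 0 ⊗ (q p* r) (suc m)
             ∎) ⟩
    p 0 ⊗ (q p* r) (suc m) ⊕ (tail p p* (q p* r)) m
      ≡⟨ p*-coeff-sucˡ p (q p* r) m ⟨
    (p p* (q p* r)) (suc m)
      ∎
    where
    tail-p*-split : tail (p p* q) ≈ ((λ j → p 0 ⊗ q (suc j)) p+ (tail p p* q))
    tail-p*-split = coeffwise (p*-coeff-sucˡ p q)

  const-𝟘 : ∀ m → const 𝟘 m ≡ 𝟘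
  const-𝟘 zero    = refl
  const-𝟘 (suc m) = refl

  -- Opaque, so that unification compares p +ᴾ q as it stands instead of unfolding it into
  -- coefficient sums.
  opaque
    infixl 6 _+ᴾ_
    infixl 7 _*ᴾ_
    infix  8 -ᴾ_

    _+ᴾ_ : Poly → Poly → Poly
    _+ᴾ_ = _p+_

    _*ᴾ_ : Poly → Poly → Poly
    _*ᴾ_ = _p*_

    -ᴾ_ : Poly → Poly
    -ᴾ_ = p-_

  opaque
    unfolding _+ᴾ_ _*ᴾ_ -ᴾ_

    Poly-isCommutativeRing : IsCommutativeRing _≈_ _+ᴾ_ _*ᴾ_ -ᴾ_ (const 𝟘) (const 𝟙)
    Poly-isCommutativeRing = record
      { isRing = record
        { +-isAbelianGroup = record
          { isGroup = record
            { isMonoid = record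
              { isSemigroup = record
                { isMagma = record
                  { isEquivalence = record { refl = ≈-refl ; sym = ≈-sym ; trans = ≈-trans }
                  ; ∙-cong = λ p≈p′ q≈q′ → coeffwise λ m → cong₂ _⊕_ (coeff p≈p′ m) (coeff q≈q′ m) }
                ; assoc = λ p q r → coeffwise λ m → +-assoc (p m) (q m) (r m) }
              ; identity = (λ p → coeffwise λ m → trans (cong (_⊕ p m) (const-𝟘 m)) (+-identityˡ (p m)))
                         , (λ p → coeffwise λ m → trans (cong (p m ⊕_) (const-𝟘 m)) (+-identityʳ (p m))) }
            ; inverse = (λ p → coeffwise λ m → trans (-‿inverseˡ (p m)) (sym (const-𝟘 m)))
                      , (λ p → coeffwise λ m → trans (-‿inverseʳ (p m)) (sym (const-𝟘 m)))
            ; ⁻¹-cong = λ p≈q → coeffwise λ m → cong ⊝_ (coeff p≈q m) }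
          ; comm = λ p q → coeffwise λ m → +-comm (p m) (q m) }
        ; *-cong = p*-cong
        ; *-assoc = λ p q r → coeffwise (p*-assoc p q r)
        ; *-identity = (λ q → coeffwise λ m → trans (const-p* 𝟙 q m) (*-identityˡ (q m)))
                     , (λ q → coeffwise λ m → trans (p*-comm q (const 𝟙) m) (trans (const-p* 𝟙 q m) (*-identityˡ (q m))))
        ; distrib = (λ r p q → coeffwise λ m → begin
                       (r p* (p p+ q)) m             ≡⟨ p*-comm r (p p+ q) m ⟩
                       ((p p+ q) p* r) m             ≡⟨ p*-distribʳ p q r m ⟩
                       (p p* r) m ⊕ (q p* r) m       ≡⟨ cong₂ _⊕_ (p*-comm p r m) (p*-comm q r m) ⟩
                       (r p* p) m ⊕ (r p* q) m       ∎)
                  , (λ r p q → coeffwise (p*-distribʳ p q r)) }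
      ; *-comm = λ p q → coeffwise (p*-comm p q) }

    const-⊕ : ∀ a b → const (a ⊕ b) ≈ (const a +ᴾ const b)
    const-⊕ a b = coeffwise λ where
      zero    → refl
      (suc m) → refl

    const-⊝ : ∀ a → const (⊝ a) ≈ (-ᴾ const a)
    const-⊝ a = coeffwise λ where
      zero    → refl
      (suc m) → refl

    const-⊗ : ∀ a b → const (a ⊗ b) ≈ (const a *ᴾ const b)
    const-⊗ a b = coeffwise λ m → trans (lemma m) (sym (const-p* a (const b) m))
      where
      lemma : ∀ m → const (a ⊗ b) m ≡ a ⊗ const b m
      lemma zero    = refl
      lemma (suc m) = sym (zeroʳ a)

  Poly-commutativeRing : CommutativeRing _ _
  Poly-commutativeRing = record { isCommutativeRing = Poly-isCommutativeRing }

open PolynomialRing using (_+ᴾ_; _*ᴾ_; -ᴾ_; Poly-commutativeRing; const-⊕; const-⊝; const-⊗)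

module PolynomialSolver where
  open import Data.Integer as ℤ using (ℤ)
  open import Data.Maybe using (Maybe; just; nothing)
  open import Algebra.Solver.Ring.AlmostCommutativeRing using (fromCommutativeRing; _-Raw-AlmostCommutative⟶_)

  ℤ⟶Poly : ℤ.+-*-rawRing -Raw-AlmostCommutative⟶ fromCommutativeRing Poly-commutativeRing
  ℤ⟶Poly = record
    { ⟦_⟧    = λ a → const (embed a)
    ; +-homo = λ a b → const-⊕ (embed a) (embed b)
    ; *-homo = λ a b → coeffwise λ m →
        trans (cong (λ c → const c m) (embed-* a b)) (coeff (const-⊗ (embed a) (embed b)) m)
    ; -‿homo = λ a → const-⊝ (embed a)
    ; 0-homo = ≈-refl
    ; 1-homo = ≈-refl }

  ℤ-coefficients≟ : ∀ a b → Maybe (const (embed a) ≈ const (embed b))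
  ℤ-coefficients≟ a b with a ℤ.≟ b
  ... | yes refl = just ≈-refl
  ... | no _     = nothing

  open import Algebra.Solver.Ring ℤ.+-*-rawRing (fromCommutativeRing Poly-commutativeRing) ℤ⟶Poly ℤ-coefficients≟ public
    using (solve; _:=_; _:+_; _:*_; :-_; _:-_; con)

open PolynomialSolver using (solve; _:=_; _:+_; _:*_; :-_; _:-_; con)

EntryPattern : Set
EntryPattern = ℕ → ℕ → Entry

Loopless : EntryPattern → Set
Loopless E = ∀ i → E i i ≡ none

Consistent : EntryPattern → Set
Consistent E = ∀ i c → E c i ≡ rev (E i c)

pathE : EntryPattern
pathE zero          zero          = none
pathE zero          (suc zero)    = undir
pathE zero          (suc (suc c)) = none
pathE (suc i)       (suc c)       = pathE i c
pathE (suc zero)    zero          = undir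
pathE (suc (suc i)) zero          = none

pathE-next : ∀ i → pathE i (suc i) ≡ undir
pathE-next zero    = refl
pathE-next (suc i) = pathE-next i

pathE-prev : ∀ i → pathE (suc i) i ≡ undir
pathE-prev zero    = refl
pathE-prev (suc i) = pathE-prev i

pathE-far : ∀ i c → c ≢ suc i → i ≢ suc c → pathE i c ≡ none
pathE-far zero          zero          _ _ = refl
pathE-far zero          (suc zero)    c≢ _ = ⊥-elim (c≢ refl)
pathE-far zero          (suc (suc c)) _ _ = refl
pathE-far (suc i)       (suc c)       c≢ i≢ = pathE-far i c (c≢ ∘ cong suc) (i≢ ∘ cong suc)
pathE-far (suc zero)    zero          _ i≢ = ⊥-elim (i≢ refl)
pathE-far (suc (suc i)) zero          _ _ = refl

pathRel≡pathE : ∀ {n} (a b : Fin n) → pathRel a b ≡ pathE (toℕ a) (toℕ b)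
pathRel≡pathE a b with toℕ b ℕ.≟ suc (toℕ a) | toℕ a ℕ.≟ suc (toℕ b)
... | yes b≡a+1 | _         = sym (trans (cong (pathE (toℕ a)) b≡a+1) (pathE-next (toℕ a)))
... | no _      | yes a≡b+1 = sym (trans (cong (λ i → pathE i (toℕ b)) a≡b+1) (pathE-prev (toℕ b)))
... | no b≢a+1  | no a≢b+1  = sym (pathE-far (toℕ a) (toℕ b) b≢a+1 a≢b+1)

nextOnPath : ℕ → ℕ → Entry
nextOnPath zero    c       = none
nextOnPath (suc r) zero    = undir
nextOnPath (suc r) (suc c) = none

-- The path on the vertices 0, …, r − 1 followed by a copy of C on the vertices r, r + 1, …
pathPlus : ℕ → EntryPattern → EntryPattern
pathPlus zero    C             = C
pathPlus (suc r) C zero    zero    = none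
pathPlus (suc r) C zero    (suc c) = nextOnPath r c
pathPlus (suc r) C (suc i) zero    = nextOnPath r i
pathPlus (suc r) C (suc i) (suc c) = pathPlus r C i c

lastOnly : ℕ → ℕ → Entry → Entry
lastOnly zero    zero    e = e
lastOnly zero    (suc c) e = none
lastOnly (suc n) zero    e = none
lastOnly (suc n) (suc c) e = lastOnly n c e

lastOnly-below : ∀ n c e → c ℕ.< n → lastOnly n c e ≡ none
lastOnly-below (suc n) zero    e _           = refl
lastOnly-below (suc n) (suc c) e (ℕ.s≤s c<n) = lastOnly-below n c e c<n

lastOnly-self : ∀ n e → lastOnly n n e ≡ e
lastOnly-self zero    e = refl
lastOnly-self (suc n) e = lastOnly-self n e

-- The cycle 0 — 1 — ⋯ — (n + 2) closed by the arc from 0 to n + 2.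
cycleE : ℕ → EntryPattern
cycleE n zero          zero          = none
cycleE n zero          (suc zero)    = undir
cycleE n zero          (suc (suc c)) = lastOnly n c fwd
cycleE n (suc i)       (suc c)       = pathE i c
cycleE n (suc zero)    zero          = undir
cycleE n (suc (suc i)) zero          = lastOnly n i bwd

rev-involutive : ∀ e → rev (rev e) ≡ e
rev-involutive none  = refl
rev-involutive undir = refl
rev-involutive fwd   = refl
rev-involutive bwd   = refl

pathE-loopless : Loopless pathE
pathE-loopless zero    = refl
pathE-loopless (suc i) = pathE-loopless i

pathE-consistent : Consistent pathE
pathE-consistent zero          zero          = refl
pathE-consistent zero          (suc zero)    = refl
pathE-consistent zero          (suc (suc c)) = refl
pathE-consistent (suc i)       (suc c)       = pathE-consistent i c
pathE-consistent (suc zero)    zero          = refl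
pathE-consistent (suc (suc i)) zero          = refl

lastOnly-rev : ∀ n c → lastOnly n c bwd ≡ rev (lastOnly n c fwd)
lastOnly-rev zero    zero    = refl
lastOnly-rev zero    (suc c) = refl
lastOnly-rev (suc n) zero    = refl
lastOnly-rev (suc n) (suc c) = lastOnly-rev n c

cycleE-loopless : ∀ n → Loopless (cycleE n)
cycleE-loopless n zero    = refl
cycleE-loopless n (suc i) = pathE-loopless i

cycleE-consistent : ∀ n → Consistent (cycleE n)
cycleE-consistent n zero          zero          = refl
cycleE-consistent n zero          (suc zero)    = refl
cycleE-consistent n zero          (suc (suc c)) = lastOnly-rev n c
cycleE-consistent n (suc i)       (suc c)       = pathE-consistent i c
cycleE-consistent n (suc zero)    zero          = refl
cycleE-consistent n (suc (suc i)) zero          =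
  trans (sym (rev-involutive (lastOnly n i fwd))) (cong rev (sym (lastOnly-rev n i)))

nextOnPath-rev : ∀ r c → nextOnPath r c ≡ rev (nextOnPath r c)
nextOnPath-rev zero    c       = refl
nextOnPath-rev (suc r) zero    = refl
nextOnPath-rev (suc r) (suc c) = refl

pathPlus-loopless : ∀ r C → Loopless C → Loopless (pathPlus r C)
pathPlus-loopless zero    C C-loopless i       = C-loopless i
pathPlus-loopless (suc r) C C-loopless zero    = refl
pathPlus-loopless (suc r) C C-loopless (suc i) = pathPlus-loopless r C C-loopless i

pathPlus-consistent : ∀ r C → Consistent C → Consistent (pathPlus r C)
pathPlus-consistent zero    C C-consistent i       c       = C-consistent i c
pathPlus-consistent (suc r) C C-consistent zero    zero    = refl
pathPlus-consistent (suc r) C C-consistent zero    (suc c) = nextOnPath-rev r c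
pathPlus-consistent (suc r) C C-consistent (suc i) zero    = nextOnPath-rev r i
pathPlus-consistent (suc r) C C-consistent (suc i) (suc c) = pathPlus-consistent r C C-consistent i c

pathPlus-no-crossing : ∀ r C i c → pathPlus r C i c ≢ none → (i <ᵇ r) ≡ (c <ᵇ r)
pathPlus-no-crossing zero          C i             c             _    = refl
pathPlus-no-crossing (suc r)       C zero          zero          edge = ⊥-elim (edge refl)
pathPlus-no-crossing (suc zero)    C zero          (suc c)       edge = ⊥-elim (edge refl)
pathPlus-no-crossing (suc (suc r)) C zero          (suc zero)    _    = refl
pathPlus-no-crossing (suc (suc r)) C zero          (suc (suc c)) edge = ⊥-elim (edge refl)
pathPlus-no-crossing (suc zero)    C (suc i)       zero          edge = ⊥-elim (edge refl)
pathPlus-no-crossing (suc (suc r)) C (suc zero)    zero          _    = refl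
pathPlus-no-crossing (suc (suc r)) C (suc (suc i)) zero          edge = ⊥-elim (edge refl)
pathPlus-no-crossing (suc r)       C (suc i)       (suc c)       edge = pathPlus-no-crossing r C i c edge

module CharacteristicPolynomials where
  open import Data.Vec.Functional using (Vector)
  open CommutativeRing Poly-commutativeRing hiding (_≈_; refl; sym; trans; zero)
  open import Algebra.Properties.Ring ring using (-0#≈0#; -‿involutive; -‿distribˡ-*; -1*x≈-x)
  open import Algebra.Properties.CommutativeMonoid.Sum +-commutativeMonoid
    using (sum; sum-syntax; sum-cong-≋; sum-remove; sum-init-last)
  open import Relation.Binary.Reasoning.Setoid setoid
  open import Data.Integer using (+_)

  opaque
    unfolding _+ᴾ_ -ᴾ_

    psum≈sum : ∀ {n} (f : Vector Poly n) → psum f ≈ sum f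
    psum≈sum {zero}  f = ≈-refl
    psum≈sum {suc n} f = coeffwise λ m → cong (f zero m ⊕_) (coeff (psum≈sum (f ∘ suc)) m)

    sign-suc : ∀ s p → sign (suc s) p ≈ - sign s p
    sign-suc s p = ≈-refl

  sum-zero : ∀ {n} (f : Vector Poly n) → (∀ j → f j ≈ 0#) → sum f ≈ 0#
  sum-zero {zero}  f f≈0 = ≈-refl
  sum-zero {suc n} f f≈0 = ≈-trans (+-cong (f≈0 zero) (sum-zero (f ∘ suc) (f≈0 ∘ suc))) (+-identityˡ 0#)

  sum-single : ∀ {n} (f : Vector Poly (suc n)) j → (∀ k → k ≢ j → f k ≈ 0#) → sum f ≈ f j
  sum-single f j others≈0 = begin
    sum f
      ≈⟨ sum-remove {i = j} f ⟩
    f j + sum (λ k → f (punchIn j k))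
      ≈⟨ +-congˡ (sum-zero _ λ k → others≈0 (punchIn j k) (Fin.punchInᵢ≢i j k)) ⟩
    f j + 0#
      ≈⟨ +-identityʳ (f j) ⟩
    f j
      ∎

  sum-last : ∀ n (f : Fin (suc n) → Poly) → (∀ (j : Fin n) → f (inject₁ j) ≈ 0#) → sum f ≈ f (fromℕ n)
  sum-last n f init≈0 = begin
    sum f                               ≈⟨ sum-init-last f ⟩
    sum (f ∘ inject₁) + f (fromℕ n)     ≈⟨ +-congʳ (sum-zero (f ∘ inject₁) init≈0) ⟩
    0# + f (fromℕ n)                    ≈⟨ +-identityˡ (f (fromℕ n)) ⟩
    f (fromℕ n)                         ∎

  ∑-linear : ∀ n x (f g : Fin n → Poly) → ∑[ i < n ] (x * f i - g i) ≈ x * sum f - sum g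
  ∑-linear zero    x f g = lemma x
    where
    lemma : ∀ x → 0# ≈ x * 0# - 0#
    lemma = solve 1 (λ x → con (+ 0) := x :* con (+ 0) :- con (+ 0)) ≈-refl
  ∑-linear (suc n) x f g = begin
    (x * f zero - g zero) + ∑[ i < n ] (x * f (suc i) - g (suc i))
      ≈⟨ +-congˡ (∑-linear n x (f ∘ suc) (g ∘ suc)) ⟩
    (x * f zero - g zero) + (x * sum (f ∘ suc) - sum (g ∘ suc))
      ≈⟨ lemma x (f zero) (g zero) (sum (f ∘ suc)) (sum (g ∘ suc)) ⟩
    x * (f zero + sum (f ∘ suc)) - (g zero + sum (g ∘ suc))
      ∎
    where
    lemma : ∀ x a b c d → (x * a - b) + (x * c - d) ≈ x * (a + c) - (b + d)
    lemma = solve 5 (λ x a b c d → (x :* a :- b) :+ (x :* c :- d) := x :* (a :+ c) :- (b :+ d)) ≈-refl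

  sign-cong : ∀ s {p q} → p ≈ q → sign s p ≈ sign s q
  sign-cong zero    p≈q = p≈q
  sign-cong (suc s) {p} {q} p≈q = begin
    sign (suc s) p  ≈⟨ sign-suc s p ⟩
    - sign s p      ≈⟨ -‿cong (sign-cong s p≈q) ⟩
    - sign s q      ≈⟨ sign-suc s q ⟨
    sign (suc s) q  ∎

  sign-zero : ∀ s → sign s 0# ≈ 0#
  sign-zero zero    = ≈-refl
  sign-zero (suc s) = begin
    sign (suc s) 0#  ≈⟨ sign-suc s 0# ⟩
    - sign s 0#      ≈⟨ -‿cong (sign-zero s) ⟩
    - 0#             ≈⟨ -0#≈0# ⟩
    0#               ∎

  sign≈* : ∀ s p → sign s p ≈ sign s 1# * p
  sign≈* zero    p = ≈-sym (*-identityˡ p)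
  sign≈* (suc s) p = begin
    sign (suc s) p        ≈⟨ sign-suc s p ⟩
    - sign s p            ≈⟨ -‿cong (sign≈* s p) ⟩
    - (sign s 1# * p)     ≈⟨ -‿distribˡ-* (sign s 1#) p ⟩
    - sign s 1# * p       ≈⟨ *-congʳ (sign-suc s 1#) ⟨
    sign (suc s) 1# * p   ∎

  sign-suc-* : ∀ s p → sign (suc s) p ≈ - (sign s 1# * p)
  sign-suc-* s p = ≈-trans (sign-suc s p) (-‿cong (sign≈* s p))

  sign-2+ : ∀ s p → sign (2 ℕ.+ s) p ≈ sign s p
  sign-2+ s p = ≈-trans (sign-suc (suc s) p) (≈-trans (-‿cong (sign-suc s p)) (-‿involutive (sign s p)))

  sign-square : ∀ s → sign s 1# * sign s 1# ≈ 1#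
  sign-square zero    = *-identityˡ 1#
  sign-square (suc s) = begin
    sign (suc s) 1# * sign (suc s) 1#   ≈⟨ *-cong (sign-suc s 1#) (sign-suc s 1#) ⟩
    - sign s 1# * - sign s 1#           ≈⟨ lemma (sign s 1#) ⟩
    sign s 1# * sign s 1#               ≈⟨ sign-square s ⟩
    1#                                  ∎
    where
    lemma : ∀ σ → - σ * - σ ≈ σ * σ
    lemma = solve 1 (λ σ → :- σ :* :- σ := σ :* σ) ≈-refl

  term-zeroˡ : ∀ s {p} q → p ≈ 0# → sign s (p * q) ≈ 0#
  term-zeroˡ s q p≈0 = ≈-trans (sign-cong s (≈-trans (*-congʳ p≈0) (zeroˡ q))) (sign-zero s)

  term-zeroʳ : ∀ s p {q} → q ≈ 0# → sign s (p * q) ≈ 0#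
  term-zeroʳ s p q≈0 = ≈-trans (sign-cong s (≈-trans (*-congˡ q≈0) (zeroʳ p))) (sign-zero s)

  -- Laplace expansion along the first row

  minor : ∀ {n} → Matrix Poly (suc n) → Fin (suc n) → Matrix Poly n
  minor M j a b = M (suc a) (punchIn j b)

  opaque
    unfolding _*ᴾ_

    det-expand : ∀ {n} (M : Matrix Poly (suc n)) → det M ≈ sum (λ j → sign (toℕ j) (M zero j * det (minor M j)))
    det-expand {n} M = psum≈sum {suc n} (λ j → sign (toℕ j) (M zero j * det (minor M j)))

  det-cong : ∀ {n} {M N : Matrix Poly n} → (∀ a b → M a b ≈ N a b) → det M ≈ det N
  det-cong {zero}  M≈N = ≈-refl
  det-cong {suc n} {M} {N} M≈N = begin
    det M                                                   ≈⟨ det-expand M ⟩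
    sum (λ j → sign (toℕ j) (M zero j * det (minor M j)))   ≈⟨ sum-cong-≋ term≈ ⟩
    sum (λ j → sign (toℕ j) (N zero j * det (minor N j)))   ≈⟨ det-expand N ⟨
    det N                                                   ∎
    where
    term≈ : ∀ j → sign (toℕ j) (M zero j * det (minor M j)) ≈ sign (toℕ j) (N zero j * det (minor N j))
    term≈ j = sign-cong (toℕ j) (*-cong (M≈N zero j) (det-cong λ a b → M≈N (suc a) (punchIn j b)))

  mutual
    det-column-at-top : ∀ {n} (M : Matrix Poly (suc n)) j → (∀ a → M (suc a) j ≈ 0#) →
                        det M ≈ sign (toℕ j) (M zero j * det (minor M j))
    det-column-at-top M j below≈0 = ≈-trans (det-expand M) (sum-single _ j other-terms≈0)
      where
      other-terms≈0 : ∀ k → k ≢ j → sign (toℕ k) (M zero k * det (minor M k)) ≈ 0#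
      other-terms≈0 k k≢j = term-zeroʳ (toℕ k) (M zero k) (det-zero-column (minor M k) (punchOut k≢j) λ a →
        ≈-trans (≈-reflexive (cong (M (suc a)) (Fin.punchIn-punchOut k≢j))) (below≈0 a))

    det-zero-column : ∀ {n} (M : Matrix Poly n) c → (∀ a → M a c ≈ 0#) → det M ≈ 0#
    det-zero-column {suc n} M c col≈0 =
      ≈-trans (det-column-at-top M c (col≈0 ∘ suc)) (term-zeroˡ (toℕ c) (det (minor M c)) (col≈0 zero))

  -- Determinants of ℕ-indexed patterns

  -- An infinite matrix; detᴾ n g is the determinant of its leading n × n block, kept opaque so that
  -- conversion checking never unfolds the Laplace expansion.
  Pattern : Set
  Pattern = ℕ → ℕ → Poly

  mat : ∀ n → Pattern → Matrix Poly n
  mat n g a b = g (toℕ a) (toℕ b)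

  -- The ℕ-counterpart of punchIn: skip j c is the c-th index different from j.
  skip : ℕ → ℕ → ℕ
  skip zero    c       = suc c
  skip (suc j) zero    = zero
  skip (suc j) (suc c) = suc (skip j c)

  skip-below : ∀ j c → c ℕ.< j → skip j c ≡ c
  skip-below (suc j) zero    _         = refl
  skip-below (suc j) (suc c) (ℕ.s≤s c<j) = cong suc (skip-below j c c<j)

  toℕ-punchIn : ∀ {n} (j : Fin (suc n)) b → toℕ (punchIn j b) ≡ skip (toℕ j) (toℕ b)
  toℕ-punchIn zero    b       = refl
  toℕ-punchIn (suc j) zero    = refl
  toℕ-punchIn (suc j) (suc b) = cong suc (toℕ-punchIn j b)

  minorAt : ℕ → Pattern → Pattern
  minorAt j g i c = g (suc i) (skip j c)

  opaque
    detᴾ : ℕ → Pattern → Poly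
    detᴾ n g = det (mat n g)

  opaque
    unfolding detᴾ

    detᴾ-minor : ∀ n g (j : Fin (suc n)) → det (minor (mat (suc n) g) j) ≈ detᴾ n (minorAt (toℕ j) g)
    detᴾ-minor n g j = det-cong λ a b → ≈-reflexive (cong (g (suc (toℕ a))) (toℕ-punchIn j b))

    detᴾ-expand : ∀ n g →
      detᴾ (suc n) g ≈ ∑[ j < suc n ] (sign (toℕ j) (g 0 (toℕ j) * detᴾ n (minorAt (toℕ j) g)))
    detᴾ-expand n g = ≈-trans (det-expand (mat (suc n) g)) (sum-cong-≋ {x = term} {y = term′} term≈term′)
      where
      term term′ : Fin (suc n) → Poly
      term j = sign (toℕ j) (g 0 (toℕ j) * det (minor (mat (suc n) g) j))
      term′ j = sign (toℕ j) (g 0 (toℕ j) * detᴾ n (minorAt (toℕ j) g))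
      term≈term′ : ∀ j → term j ≈ term′ j
      term≈term′ j = sign-cong (toℕ j) (*-congˡ (detᴾ-minor n g j))

    detᴾ-column : ∀ n g (j : Fin (suc n)) → (∀ (i : Fin n) → g (suc (toℕ i)) (toℕ j) ≈ 0#) →
                     detᴾ (suc n) g ≈ sign (toℕ j) (g 0 (toℕ j) * detᴾ n (minorAt (toℕ j) g))
    detᴾ-column n g j below≈0 =
      ≈-trans (det-column-at-top (mat (suc n) g) j below≈0) (sign-cong (toℕ j) (*-congˡ (detᴾ-minor n g j)))

    detᴾ-0×0 : ∀ g → detᴾ 0 g ≈ 1#
    detᴾ-0×0 g = ≈-refl

    detᴾ-cong : ∀ n {g h} → (∀ (i c : Fin n) → g (toℕ i) (toℕ c) ≈ h (toℕ i) (toℕ c)) → detᴾ n g ≈ detᴾ n h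
    detᴾ-cong n g≈h = det-cong {n} g≈h

  detᴾ-1×1 : ∀ g → detᴾ 1 g ≈ g 0 0
  detᴾ-1×1 g = ≈-trans (detᴾ-column 0 g zero λ ()) (≈-trans (*-congˡ (detᴾ-0×0 (minorAt 0 g))) (*-identityʳ (g 0 0)))

  detᴾ-row0₂ : ∀ n g → (∀ (c : Fin n) → g 0 (2 ℕ.+ toℕ c) ≈ 0#) →
    detᴾ (2 ℕ.+ n) g ≈ g 0 0 * detᴾ (suc n) (minorAt 0 g) - g 0 1 * detᴾ (suc n) (minorAt 1 g)
  detᴾ-row0₂ n g row≈0 = begin
    detᴾ (2 ℕ.+ n) g                        ≈⟨ detᴾ-expand (suc n) g ⟩
    t₀ + (t₁ + sum rest)                    ≈⟨ +-congˡ (+-congˡ (sum-zero rest rest≈0)) ⟩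
    t₀ + (t₁ + 0#)                          ≈⟨ +-congˡ (≈-trans (+-identityʳ t₁) (sign-suc 0 (g 0 1 * D₁))) ⟩
    t₀ - g 0 1 * D₁                         ∎
    where
    D₁ = detᴾ (suc n) (minorAt 1 g)
    term : Fin (2 ℕ.+ n) → Poly
    term j = sign (toℕ j) (g 0 (toℕ j) * detᴾ (suc n) (minorAt (toℕ j) g))
    t₀ = term zero
    t₁ = term (suc zero)
    rest : Fin n → Poly
    rest j = term (suc (suc j))
    rest≈0 : ∀ j → rest j ≈ 0#
    rest≈0 j = term-zeroˡ (toℕ (suc (suc j))) (detᴾ (suc n) (minorAt (toℕ (suc (suc j))) g)) (row≈0 j)

  detᴾ-row0₃ : ∀ n g → (∀ (c : Fin n) → g 0 (3 ℕ.+ toℕ c) ≈ 0#) →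
    detᴾ (3 ℕ.+ n) g ≈ g 0 0 * detᴾ (2 ℕ.+ n) (minorAt 0 g) - g 0 1 * detᴾ (2 ℕ.+ n) (minorAt 1 g)
                                                          + g 0 2 * detᴾ (2 ℕ.+ n) (minorAt 2 g)
  detᴾ-row0₃ n g row≈0 = begin
    detᴾ (3 ℕ.+ n) g                    ≈⟨ detᴾ-expand (2 ℕ.+ n) g ⟩
    t₀ + (t₁ + (t₂ + sum rest))         ≈⟨ +-congˡ (+-congˡ (+-congˡ (sum-zero rest rest≈0))) ⟩
    t₀ + (t₁ + (t₂ + 0#))               ≈⟨ +-congˡ (+-congˡ (+-identityʳ t₂)) ⟩
    t₀ + (t₁ + t₂)                      ≈⟨ +-assoc t₀ t₁ t₂ ⟨
    t₀ + t₁ + t₂                        ≈⟨ +-cong (+-congˡ (sign-suc 0 _))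
                                                  (≈-trans (sign-suc 1 _) (-‿cong (sign-suc 0 _))) ⟩
    t₀ - g 0 1 * D₁ + - - (g 0 2 * D₂)  ≈⟨ +-congˡ (-‿involutive (g 0 2 * D₂)) ⟩
    t₀ - g 0 1 * D₁ + g 0 2 * D₂        ∎
    where
    D₁ = detᴾ (2 ℕ.+ n) (minorAt 1 g)
    D₂ = detᴾ (2 ℕ.+ n) (minorAt 2 g)
    term : Fin (3 ℕ.+ n) → Poly
    term j = sign (toℕ j) (g 0 (toℕ j) * detᴾ (2 ℕ.+ n) (minorAt (toℕ j) g))
    t₀ = term zero
    t₁ = term (suc zero)
    t₂ = term (suc (suc zero))
    rest : Fin n → Poly
    rest j = term (suc (suc (suc j)))
    rest≈0 : ∀ j → rest j ≈ 0#
    rest≈0 j = term-zeroˡ (3 ℕ.+ toℕ j) (detᴾ (2 ℕ.+ n) (minorAt (3 ℕ.+ toℕ j) g)) (row≈0 j)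

  detᴾ-row0-ends : ∀ n g → (∀ (c : Fin n) → g 0 (2 ℕ.+ toℕ c) ≈ 0#) →
    detᴾ (3 ℕ.+ n) g ≈ g 0 0 * detᴾ (2 ℕ.+ n) (minorAt 0 g) - g 0 1 * detᴾ (2 ℕ.+ n) (minorAt 1 g)
                       + sign (2 ℕ.+ n) (g 0 (2 ℕ.+ n) * detᴾ (2 ℕ.+ n) (minorAt (2 ℕ.+ n) g))
  detᴾ-row0-ends n g middle≈0 = begin
    detᴾ (3 ℕ.+ n) g                       ≈⟨ detᴾ-expand (2 ℕ.+ n) g ⟩
    t₀ + (t₁ + sum rest)                   ≈⟨ +-congˡ (+-congˡ (sum-last n rest rest≈0)) ⟩
    t₀ + (t₁ + rest (fromℕ n))             ≈⟨ +-assoc t₀ t₁ _ ⟨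
    t₀ + t₁ + rest (fromℕ n)               ≈⟨ +-cong (+-congˡ (sign-suc 0 _))
                                                     (≈-reflexive (cong last (Fin.toℕ-fromℕ n))) ⟩
    t₀ - g 0 1 * detᴾ (2 ℕ.+ n) (minorAt 1 g) + last n
                                           ∎
    where
    term : Fin (3 ℕ.+ n) → Poly
    term j = sign (toℕ j) (g 0 (toℕ j) * detᴾ (2 ℕ.+ n) (minorAt (toℕ j) g))
    t₀ = term zero
    t₁ = term (suc zero)
    rest : Fin (suc n) → Poly
    rest j = term (suc (suc j))
    last : ℕ → Poly
    last k = sign (2 ℕ.+ k) (g 0 (2 ℕ.+ k) * detᴾ (2 ℕ.+ n) (minorAt (2 ℕ.+ k) g))
    rest≈0 : ∀ (j : Fin n) → rest (inject₁ j) ≈ 0#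
    rest≈0 j = term-zeroˡ (2 ℕ.+ toℕ (inject₁ j)) (detᴾ (2 ℕ.+ n) (minorAt (2 ℕ.+ toℕ (inject₁ j)) g))
                 (≈-trans (≈-reflexive (cong (λ k → g 0 (2 ℕ.+ k)) (Fin.toℕ-inject₁ j))) (middle≈0 j))

  detᴾ-tridiagonal : ∀ n g → g 0 0 ≈ X → g 0 1 ≈ - 1# → g 1 0 ≈ - 1# →
    (∀ (c : Fin n) → g 0 (2 ℕ.+ toℕ c) ≈ 0#) → (∀ (i : Fin n) → g (2 ℕ.+ toℕ i) 0 ≈ 0#) →
    detᴾ (2 ℕ.+ n) g ≈ X * detᴾ (suc n) (minorAt 0 g) - detᴾ n (minorAt 0 (minorAt 0 g))
  detᴾ-tridiagonal n g g₀₀ g₀₁ g₁₀ row≈0 column≈0 = begin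
    detᴾ (2 ℕ.+ n) g                           ≈⟨ detᴾ-row0₂ n g row≈0 ⟩
    g 0 0 * D₁ - g 0 1 * detᴾ (suc n) (minorAt 1 g)
      ≈⟨ +-cong (*-congʳ g₀₀)
                (-‿cong (*-cong g₀₁ (≈-trans (detᴾ-column n (minorAt 1 g) zero column≈0) (*-congʳ g₁₀)))) ⟩
    X * D₁ - (- 1#) * ((- 1#) * D₂)                 ≈⟨ lemma X D₁ D₂ ⟩
    X * D₁ - D₂                                     ∎
    where
    D₁ = detᴾ (suc n) (minorAt 0 g)
    D₂ = detᴾ n (minorAt 0 (minorAt 0 g))
    lemma : ∀ x a b → x * a - (- 1#) * ((- 1#) * b) ≈ x * a - b
    lemma = solve 3 (λ x a b → x :* a :- (:- con (+ 1)) :* ((:- con (+ 1)) :* b) := x :* a :- b) ≈-refl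

  infixr 5 _◂_
  _◂_ : (ℕ → Poly) → Pattern → Pattern
  (v ◂ g) i zero    = v i
  (v ◂ g) i (suc c) = g i c

  detᴾ-minorAt-suc-◂ : ∀ n j v g → detᴾ n (minorAt (suc j) (v ◂ g)) ≈ detᴾ n ((v ∘ suc) ◂ minorAt j g)
  detᴾ-minorAt-suc-◂ n j v g = detᴾ-cong n λ i c → ≈-reflexive (entry (toℕ i) (toℕ c))
    where
    entry : ∀ i c → minorAt (suc j) (v ◂ g) i c ≡ ((v ∘ suc) ◂ minorAt j g) i c
    entry i zero    = refl
    entry i (suc c) = refl

  -- The path, the cycle and their disjoint union

  xδ : ℕ → ℕ → Poly
  xδ zero    zero    = X
  xδ zero    (suc c) = 0#
  xδ (suc i) zero    = 0#
  xδ (suc i) (suc c) = xδ i c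

  charPattern : EntryPattern → Pattern
  charPattern E i c = xδ i c - const (entryH (E i c))

  minus-none : ∀ p → p - const (entryH none) ≈ p
  minus-none p = ≈-trans (+-congˡ -0#≈0#) (+-identityʳ p)

  zero-minus : ∀ e → 0# - const (entryH e) ≈ - const (entryH e)
  zero-minus e = +-identityˡ _

  -- U n = U_{n−1}(x/2); U (suc n) is the characteristic polynomial of Pₙ (detᴾ-path).
  U : ℕ → Poly
  U zero          = 0#
  U (suc zero)    = 1#
  U (suc (suc n)) = X * U (suc n) - U n

  ∑-U-recurrence : ∀ n (w : ℕ → Poly) →
    ∑[ i < suc n ] (w (toℕ i) * U (2 ℕ.+ toℕ i)) ≈
    X * ∑[ i < suc n ] (w (toℕ i) * U (suc (toℕ i))) - (w 0 * 0# + ∑[ i < n ] (w (suc (toℕ i)) * U (suc (toℕ i))))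
  ∑-U-recurrence n w = ≈-trans (sum-cong-≋ {x = lhs} {y = rhs} pointwise)
                               (∑-linear (suc n) X (λ i → w (toℕ i) * U (suc (toℕ i))) (λ i → w (toℕ i) * U (toℕ i)))
    where
    lhs rhs : Fin (suc n) → Poly
    lhs i = w (toℕ i) * U (2 ℕ.+ toℕ i)
    rhs i = X * (w (toℕ i) * U (suc (toℕ i))) - w (toℕ i) * U (toℕ i)
    lemma : ∀ w x a b → w * (x * a - b) ≈ x * (w * a) - w * b
    lemma = solve 4 (λ w x a b → w :* (x :* a :- b) := x :* (w :* a) :- w :* b) ≈-refl
    pointwise : ∀ i → lhs i ≈ rhs i
    pointwise i = lemma (w (toℕ i)) X (U (suc (toℕ i))) (U (toℕ i))

  U-+ : ∀ a b → U (suc (a ℕ.+ b)) ≈ U (suc a) * U (suc b) - U a * U b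
  U-+ zero          b = lemma (U (suc b)) (U b)
    where
    lemma : ∀ p q → p ≈ 1# * p - 0# * q
    lemma = solve 2 (λ p q → p := con (+ 1) :* p :- con (+ 0) :* q) ≈-refl
  U-+ (suc zero)    b = lemma X (U (suc b)) (U b)
    where
    lemma : ∀ x p q → x * p - q ≈ (x * 1# - 0#) * p - 1# * q
    lemma = solve 3 (λ x p q → x :* p :- q := (x :* con (+ 1) :- con (+ 0)) :* p :- con (+ 1) :* q) ≈-refl
  U-+ (suc (suc a)) b = begin
    X * U (2 ℕ.+ (a ℕ.+ b)) - U (suc (a ℕ.+ b))
      ≈⟨ +-cong (*-congˡ (U-+ (suc a) b)) (-‿cong (U-+ a b)) ⟩
    X * (U (2 ℕ.+ a) * U (suc b) - U (suc a) * U b) - (U (suc a) * U (suc b) - U a * U b)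
      ≈⟨ lemma X (U (2 ℕ.+ a)) (U (suc a)) (U a) (U (suc b)) (U b) ⟩
    (X * U (2 ℕ.+ a) - U (suc a)) * U (suc b) - (X * U (suc a) - U a) * U b
      ∎
    where
    lemma : ∀ x a₂ a₁ a₀ b₁ b₀ →
      x * (a₂ * b₁ - a₁ * b₀) - (a₁ * b₁ - a₀ * b₀) ≈ (x * a₂ - a₁) * b₁ - (x * a₁ - a₀) * b₀
    lemma = solve 6 (λ x a₂ a₁ a₀ b₁ b₀ →
      x :* (a₂ :* b₁ :- a₁ :* b₀) :- (a₁ :* b₁ :- a₀ :* b₀) :=
      (x :* a₂ :- a₁) :* b₁ :- (x :* a₁ :- a₀) :* b₀) ≈-refl

  pathChar : Pattern
  pathChar = charPattern pathE

  pathTail : Pattern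
  pathTail i c = pathChar i (suc c)

  pathBelow : Pattern
  pathBelow i c = pathChar (suc i) c

  detᴾ-path : ∀ n → detᴾ n pathChar ≈ U (suc n)
  detᴾ-path zero          = detᴾ-0×0 pathChar
  detᴾ-path (suc zero)    = begin
    detᴾ 1 pathChar   ≈⟨ detᴾ-1×1 pathChar ⟩
    X - 0#            ≈⟨ +-congʳ (*-identityʳ X) ⟨
    U 2               ∎
  detᴾ-path (suc (suc n)) = begin
    detᴾ (2 ℕ.+ n) pathChar
      ≈⟨ detᴾ-tridiagonal n pathChar (minus-none X) (zero-minus undir) (zero-minus undir)
           (λ _ → minus-none 0#) (λ _ → minus-none 0#) ⟩
    X * detᴾ (suc n) pathChar - detᴾ n pathChar
      ≈⟨ +-cong (*-congˡ (detᴾ-path (suc n))) (-‿cong (detᴾ-path n)) ⟩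
    U (3 ℕ.+ n)
      ∎

  detᴾ-pathPlus : ∀ r s C → detᴾ (r ℕ.+ s) (charPattern (pathPlus r C)) ≈ U (suc r) * detᴾ s (charPattern C)
  detᴾ-pathPlus zero s C = ≈-sym (*-identityˡ _)
  detᴾ-pathPlus (suc zero) s C = begin
    detᴾ (suc s) (charPattern (pathPlus 1 C))
      ≈⟨ detᴾ-column s (charPattern (pathPlus 1 C)) zero (λ _ → minus-none 0#) ⟩
    (X - 0#) * detᴾ s (charPattern C)
      ≈⟨ *-congʳ (+-congʳ (*-identityʳ X)) ⟨
    U 2 * detᴾ s (charPattern C)
      ∎
  detᴾ-pathPlus (suc (suc r)) s C = begin
    detᴾ (2 ℕ.+ (r ℕ.+ s)) g
      ≈⟨ detᴾ-tridiagonal (r ℕ.+ s) g (minus-none X) (zero-minus undir) (zero-minus undir)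
           (λ _ → minus-none 0#) (λ _ → minus-none 0#) ⟩
    X * detᴾ (suc r ℕ.+ s) (charPattern (pathPlus (suc r) C)) - detᴾ (r ℕ.+ s) (charPattern (pathPlus r C))
      ≈⟨ +-cong (*-congˡ (detᴾ-pathPlus (suc r) s C)) (-‿cong (detᴾ-pathPlus r s C)) ⟩
    X * (U (2 ℕ.+ r) * D) - U (suc r) * D
      ≈⟨ lemma X (U (2 ℕ.+ r)) (U (suc r)) D ⟩
    U (3 ℕ.+ r) * D
      ∎
    where
    g = charPattern (pathPlus (suc (suc r)) C)
    D = detᴾ s (charPattern C)
    lemma : ∀ x a b d → x * (a * d) - b * d ≈ (x * a - b) * d
    lemma = solve 4 (λ x a b d → x :* (a :* d) :- b :* d := (x :* a :- b) :* d) ≈-refl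

  detᴾ-◂-pathTail : ∀ m v → detᴾ (suc m) (v ◂ pathTail) ≈ ∑[ i < suc m ] (v (toℕ i) * U (suc m ∸ toℕ i))
  detᴾ-◂-pathTail zero v = begin
    detᴾ 1 (v ◂ pathTail)   ≈⟨ detᴾ-1×1 (v ◂ pathTail) ⟩
    v 0                     ≈⟨ *-identityʳ (v 0) ⟨
    v 0 * 1#                ≈⟨ +-identityʳ (v 0 * 1#) ⟨
    v 0 * U 1 + 0#          ∎
  detᴾ-◂-pathTail (suc m) v = begin
    detᴾ (2 ℕ.+ m) (v ◂ pathTail)
      ≈⟨ detᴾ-row0₂ m (v ◂ pathTail) (λ _ → minus-none 0#) ⟩
    v 0 * detᴾ (suc m) pathChar - pathTail 0 0 * detᴾ (suc m) (minorAt 1 (v ◂ pathTail))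
      ≈⟨ +-cong (*-congˡ (detᴾ-path (suc m)))
                (-‿cong (*-cong (zero-minus undir)
                  (detᴾ-minorAt-suc-◂ (suc m) 0 v pathTail))) ⟩
    v 0 * U (2 ℕ.+ m) - (- 1#) * detᴾ (suc m) ((v ∘ suc) ◂ pathTail)
      ≈⟨ +-congˡ (-‿cong (*-congˡ (detᴾ-◂-pathTail m (v ∘ suc)))) ⟩
    v 0 * U (2 ℕ.+ m) - (- 1#) * ∑[ i < suc m ] (v (suc (toℕ i)) * U (suc m ∸ toℕ i))
      ≈⟨ lemma (v 0 * U (2 ℕ.+ m)) _ ⟩
    ∑[ i < 2 ℕ.+ m ] (v (toℕ i) * U (2 ℕ.+ m ∸ toℕ i))
      ∎
    where
    lemma : ∀ a b → a - (- 1#) * b ≈ a + b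
    lemma = solve 2 (λ a b → a :- (:- con (+ 1)) :* b := a :+ b) ≈-refl

  detᴾ-pathBelow : ∀ n → detᴾ n pathBelow ≈ sign n 1#
  detᴾ-pathBelow zero    = detᴾ-0×0 pathBelow
  detᴾ-pathBelow (suc n) = begin
    detᴾ (suc n) pathBelow             ≈⟨ detᴾ-column n pathBelow zero (λ _ → minus-none 0#) ⟩
    pathChar 1 0 * detᴾ n pathBelow    ≈⟨ *-cong (zero-minus undir) (detᴾ-pathBelow n) ⟩
    - 1# * sign n 1#                   ≈⟨ -1*x≈-x (sign n 1#) ⟩
    - sign n 1#                        ≈⟨ sign-suc n 1# ⟨
    sign (suc n) 1#                    ∎

  detᴾ-◂-pathChar-minor₂ : ∀ m v →
    detᴾ (2 ℕ.+ m) (minorAt 2 (v ◂ pathChar)) ≈ detᴾ (suc m) (((v ∘ suc) ∘ suc) ◂ pathChar)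
  detᴾ-◂-pathChar-minor₂ m v = begin
    detᴾ (2 ℕ.+ m) (minorAt 2 (v ◂ pathChar))
      ≈⟨ detᴾ-minorAt-suc-◂ (2 ℕ.+ m) 1 v pathChar ⟩
    detᴾ (2 ℕ.+ m) h
      ≈⟨ detᴾ-column (suc m) h (suc zero) (λ _ → minus-none 0#) ⟩
    sign 1 (pathChar 1 0 * detᴾ (suc m) (minorAt 1 h))
      ≈⟨ sign-suc 0 _ ⟩
    - (pathChar 1 0 * detᴾ (suc m) (minorAt 1 h))
      ≈⟨ -‿cong (*-cong (zero-minus undir) (detᴾ-minorAt-suc-◂ (suc m) 0 (v ∘ suc) (minorAt 1 pathChar))) ⟩
    - (- 1# * detᴾ (suc m) (((v ∘ suc) ∘ suc) ◂ pathChar))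
      ≈⟨ lemma _ ⟩
    detᴾ (suc m) (((v ∘ suc) ∘ suc) ◂ pathChar)
      ∎
    where
    h = (v ∘ suc) ◂ minorAt 1 pathChar
    lemma : ∀ d → - (- 1# * d) ≈ d
    lemma = solve 1 (λ d → :- (:- con (+ 1) :* d) := d) ≈-refl

  detᴾ-◂-pathChar : ∀ m v → detᴾ (suc m) (v ◂ pathChar) ≈ sign m (∑[ i < suc m ] (v (toℕ i) * U (suc (toℕ i))))
  detᴾ-◂-pathChar zero v = begin
    detᴾ 1 (v ◂ pathChar)   ≈⟨ detᴾ-1×1 (v ◂ pathChar) ⟩
    v 0                     ≈⟨ *-identityʳ (v 0) ⟨
    v 0 * 1#                ≈⟨ +-identityʳ (v 0 * 1#) ⟨
    v 0 * U 1 + 0#          ∎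
  detᴾ-◂-pathChar (suc zero) v = begin
    detᴾ 2 (v ◂ pathChar)
      ≈⟨ detᴾ-row0₂ 0 (v ◂ pathChar) (λ ()) ⟩
    v 0 * detᴾ 1 pathBelow - pathChar 0 0 * detᴾ 1 (minorAt 1 (v ◂ pathChar))
      ≈⟨ +-cong (*-congˡ (≈-trans (detᴾ-1×1 pathBelow) (zero-minus undir)))
                (-‿cong (*-cong (minus-none X) (detᴾ-1×1 _))) ⟩
    v 0 * - 1# - X * v 1
      ≈⟨ lemma (v 0) (v 1) X ⟩
    - (v 0 * 1# + (v 1 * (X * 1# - 0#) + 0#))
      ≈⟨ sign-suc 0 _ ⟨
    sign 1 (∑[ i < 2 ] (v (toℕ i) * U (suc (toℕ i))))
      ∎
    where
    lemma : ∀ a b x → a * - 1# - x * b ≈ - (a * 1# + (b * (x * 1# - 0#) + 0#))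
    lemma = solve 3 (λ a b x → a :* (:- con (+ 1)) :- x :* b :=
                               :- (a :* con (+ 1) :+ (b :* (x :* con (+ 1) :- con (+ 0)) :+ con (+ 0)))) ≈-refl
  detᴾ-◂-pathChar (suc (suc m)) v = begin
    detᴾ (3 ℕ.+ m) (v ◂ pathChar)
      ≈⟨ detᴾ-row0₃ m (v ◂ pathChar) (λ _ → minus-none 0#) ⟩
    v 0 * detᴾ (2 ℕ.+ m) pathBelow - pathChar 0 0 * detᴾ (2 ℕ.+ m) (minorAt 1 (v ◂ pathChar))
                                   + pathChar 0 1 * detᴾ (2 ℕ.+ m) (minorAt 2 (v ◂ pathChar))
      ≈⟨ +-cong (+-cong (*-congˡ (detᴾ-pathBelow (2 ℕ.+ m)))
                        (-‿cong (*-cong (minus-none X) (≈-trans (detᴾ-minorAt-suc-◂ (2 ℕ.+ m) 0 v pathChar)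
                                                               (detᴾ-◂-pathChar (suc m) (v ∘ suc))))))
                (*-cong (zero-minus undir) (≈-trans (detᴾ-◂-pathChar-minor₂ m v)
                                                    (detᴾ-◂-pathChar m ((v ∘ suc) ∘ suc)))) ⟩
    v 0 * sign (2 ℕ.+ m) 1# - X * sign (suc m) S₁ + - 1# * sign m S₂
      ≈⟨ +-cong (+-cong (*-congˡ (sign-2+ m 1#)) (-‿cong (*-congˡ (sign-suc-* m S₁)))) (*-congˡ (sign≈* m S₂)) ⟩
    v 0 * σ - X * - (σ * S₁) + - 1# * (σ * S₂)
      ≈⟨ lemma (v 0) (v 1) X σ S₁ S₂ ⟩
    σ * (v 0 * 1# + (X * S₁ - (v 1 * 0# + S₂)))
      ≈⟨ *-congˡ (+-congˡ (∑-U-recurrence (suc m) (v ∘ suc))) ⟨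
    σ * ∑[ i < 3 ℕ.+ m ] (v (toℕ i) * U (suc (toℕ i)))
      ≈⟨ ≈-trans (sign-2+ m _) (sign≈* m _) ⟨
    sign (2 ℕ.+ m) (∑[ i < 3 ℕ.+ m ] (v (toℕ i) * U (suc (toℕ i))))
      ∎
    where
    σ = sign m 1#
    S₁ = ∑[ i < 2 ℕ.+ m ] (v (suc (toℕ i)) * U (suc (toℕ i)))
    S₂ = ∑[ i < suc m ] (v (2 ℕ.+ toℕ i) * U (suc (toℕ i)))
    lemma : ∀ a b x σ s₁ s₂ →
      a * σ - x * - (σ * s₁) + - 1# * (σ * s₂) ≈ σ * (a * 1# + (x * s₁ - (b * 0# + s₂)))
    lemma = solve 6 (λ a b x σ s₁ s₂ →
      a :* σ :- x :* :- (σ :* s₁) :+ :- con (+ 1) :* (σ :* s₂) :=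
      σ :* (a :* con (+ 1) :+ (x :* s₁ :- (b :* con (+ 0) :+ s₂)))) ≈-refl

  𝕚-square : const 𝕚 * const 𝕚 ≈ - 1#
  𝕚-square = ≈-trans (≈-sym (const-⊗ 𝕚 𝕚)) (const-⊝ 𝟙)

  cycleChar : ℕ → Pattern
  cycleChar n = charPattern (cycleE n)

  cycleColumn : ℕ → ℕ → Poly
  cycleColumn n i = cycleChar n (suc i) 0

  lastOnly-char-below : ∀ n c e → c ℕ.< n → 0# - const (entryH (lastOnly n c e)) ≈ 0#
  lastOnly-char-below n c e c<n =
    ≈-trans (≈-reflexive (cong (λ e′ → 0# - const (entryH e′)) (lastOnly-below n c e c<n))) (minus-none 0#)

  lastOnly-char-self : ∀ n e → 0# - const (entryH (lastOnly n n e)) ≈ - const (entryH e)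
  lastOnly-char-self n e =
    ≈-trans (≈-reflexive (cong (λ e′ → 0# - const (entryH e′)) (lastOnly-self n e))) (zero-minus e)

  ∑-cycleColumn : ∀ n (f : ℕ → Poly) → ∑[ i < suc n ] (cycleColumn n (suc (toℕ i)) * f (toℕ i)) ≈ const 𝕚 * f n
  ∑-cycleColumn n f = begin
    ∑[ i < suc n ] (cycleColumn n (suc (toℕ i)) * f (toℕ i))
      ≈⟨ sum-last n (λ i → cycleColumn n (suc (toℕ i)) * f (toℕ i))
                    (λ j → ≈-trans (*-congʳ (lastOnly-char-below n _ bwd (Fin.inject₁ℕ< j))) (zeroˡ _)) ⟩
    cycleColumn n (suc (toℕ (fromℕ n))) * f (toℕ (fromℕ n))
      ≈⟨ ≈-reflexive (cong (λ k → cycleColumn n (suc k) * f k) (Fin.toℕ-fromℕ n)) ⟩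
    cycleColumn n (suc n) * f n
      ≈⟨ *-congʳ (≈-trans (lastOnly-char-self n bwd) (≈-trans (-‿cong (const-⊝ 𝕚)) (-‿involutive (const 𝕚)))) ⟩
    const 𝕚 * f n
      ∎

  detᴾ-cycle-minor₁ : ∀ n → detᴾ (2 ℕ.+ n) (minorAt 1 (cycleChar n)) ≈ - 1# * U (2 ℕ.+ n) + const 𝕚 * 1#
  detᴾ-cycle-minor₁ n = begin
    detᴾ (2 ℕ.+ n) (minorAt 1 (cycleChar n))
      ≈⟨ detᴾ-cong (2 ℕ.+ n) (λ i c → ≈-reflexive (entry (toℕ i) (toℕ c))) ⟩
    detᴾ (2 ℕ.+ n) (cycleColumn n ◂ pathTail)
      ≈⟨ detᴾ-◂-pathTail (suc n) (cycleColumn n) ⟩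
    cycleColumn n 0 * U (2 ℕ.+ n) + ∑[ i < suc n ] (cycleColumn n (suc (toℕ i)) * U (suc n ∸ toℕ i))
      ≈⟨ +-cong (*-congʳ (zero-minus undir)) (∑-cycleColumn n (λ k → U (suc n ∸ k))) ⟩
    - 1# * U (2 ℕ.+ n) + const 𝕚 * U (suc n ∸ n)
      ≈⟨ +-congˡ (*-congˡ (≈-reflexive (cong U (ℕ.m+n∸n≡m 1 n)))) ⟩
    - 1# * U (2 ℕ.+ n) + const 𝕚 * 1#
      ∎
    where
    entry : ∀ i c → minorAt 1 (cycleChar n) i c ≡ (cycleColumn n ◂ pathTail) i c
    entry i zero    = refl
    entry i (suc c) = refl

  detᴾ-cycle-minorLast : ∀ n →
    detᴾ (2 ℕ.+ n) (minorAt (2 ℕ.+ n) (cycleChar n)) ≈ sign (suc n) (- 1# * 1# + const 𝕚 * U (2 ℕ.+ n))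
  detᴾ-cycle-minorLast n = begin
    detᴾ (2 ℕ.+ n) (minorAt (2 ℕ.+ n) (cycleChar n))
      ≈⟨ detᴾ-cong (2 ℕ.+ n) (λ i c → ≈-reflexive (entry i c)) ⟩
    detᴾ (2 ℕ.+ n) (cycleColumn n ◂ pathChar)
      ≈⟨ detᴾ-◂-pathChar (suc n) (cycleColumn n) ⟩
    sign (suc n) (cycleColumn n 0 * 1# + ∑[ i < suc n ] (cycleColumn n (suc (toℕ i)) * U (2 ℕ.+ toℕ i)))
      ≈⟨ sign-cong (suc n) (+-cong (*-congʳ (zero-minus undir)) (∑-cycleColumn n (λ k → U (2 ℕ.+ k)))) ⟩
    sign (suc n) (- 1# * 1# + const 𝕚 * U (2 ℕ.+ n))
      ∎
    where
    entry : ∀ (i c : Fin (2 ℕ.+ n)) →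
            minorAt (2 ℕ.+ n) (cycleChar n) (toℕ i) (toℕ c) ≡ (cycleColumn n ◂ pathChar) (toℕ i) (toℕ c)
    entry i c rewrite skip-below (2 ℕ.+ n) (toℕ c) (Fin.toℕ<n c) with toℕ c
    ... | zero  = refl
    ... | suc _ = refl

  detᴾ-cycle : ∀ n → detᴾ (3 ℕ.+ n) (cycleChar n) ≈ U (4 ℕ.+ n) - U (2 ℕ.+ n)
  detᴾ-cycle n = begin
    detᴾ (3 ℕ.+ n) (cycleChar n)
      ≈⟨ detᴾ-row0-ends n (cycleChar n) (λ j → lastOnly-char-below n _ fwd (Fin.toℕ<n j)) ⟩
    cycleChar n 0 0 * detᴾ (2 ℕ.+ n) pathChar - cycleChar n 0 1 * detᴾ (2 ℕ.+ n) (minorAt 1 (cycleChar n))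
      + sign (2 ℕ.+ n) (cycleChar n 0 (2 ℕ.+ n) * detᴾ (2 ℕ.+ n) (minorAt (2 ℕ.+ n) (cycleChar n)))
      ≈⟨ +-cong (+-cong (*-cong (minus-none X) (detᴾ-path (2 ℕ.+ n)))
                        (-‿cong (*-cong (zero-minus undir) (detᴾ-cycle-minor₁ n))))
                (sign-cong (2 ℕ.+ n) (*-cong (lastOnly-char-self n fwd) (detᴾ-cycle-minorLast n))) ⟩
    X * U₃ - - 1# * (- 1# * U₂ + I * 1#) + sign (2 ℕ.+ n) (- I * sign (suc n) (- 1# * 1# + I * U₂))
      ≈⟨ +-congˡ (≈-trans (sign-2+ n _) (≈-trans (sign≈* n _) (*-congˡ (*-congˡ (sign-suc-* n _))))) ⟩
    X * U₃ - - 1# * (- 1# * U₂ + I * 1#) + σ * (- I * - (σ * (- 1# * 1# + I * U₂)))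
      ≈⟨ expand X U₃ U₂ I σ ⟩
    X * U₃ - U₂ - U₂ + (σ * σ - 1#) * (I * (- 1# + I * U₂)) + (I * I + 1#) * U₂
      ≈⟨ +-cong (+-congˡ (*-congʳ (≈-trans (+-congʳ (sign-square n)) (-‿inverseʳ 1#))))
                (*-congʳ (≈-trans (+-congʳ 𝕚-square) (-‿inverseˡ 1#))) ⟩
    X * U₃ - U₂ - U₂ + 0# * (I * (- 1# + I * U₂)) + 0# * U₂
      ≈⟨ cancel (X * U₃ - U₂ - U₂) (I * (- 1# + I * U₂)) U₂ ⟩
    U (4 ℕ.+ n) - U₂
      ∎
    where
    I = const 𝕚
    σ = sign n 1#
    U₂ = U (2 ℕ.+ n)
    U₃ = U (3 ℕ.+ n)
    -- A ring identity in which σ² = 1 and i² = −1, unknown to the solver, appear as correction terms.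
    expand : ∀ x u₃ u₂ i σ →
      x * u₃ - - 1# * (- 1# * u₂ + i * 1#) + σ * (- i * - (σ * (- 1# * 1# + i * u₂))) ≈
      x * u₃ - u₂ - u₂ + (σ * σ - 1#) * (i * (- 1# + i * u₂)) + (i * i + 1#) * u₂
    expand = solve 5 (λ x u₃ u₂ i σ →
      x :* u₃ :- :- con (+ 1) :* (:- con (+ 1) :* u₂ :+ i :* con (+ 1))
        :+ σ :* (:- i :* :- (σ :* (:- con (+ 1) :* con (+ 1) :+ i :* u₂))) :=
      x :* u₃ :- u₂ :- u₂ :+ (σ :* σ :- con (+ 1)) :* (i :* (:- con (+ 1) :+ i :* u₂)) :+ (i :* i :+ con (+ 1)) :* u₂)
      ≈-refl
    cancel : ∀ a b c → a + 0# * b + 0# * c ≈ a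
    cancel = solve 3 (λ a b c → a :+ con (+ 0) :* b :+ con (+ 0) :* c := a) ≈-refl

  detᴾ-pathPlusCycle : ∀ m →
    detᴾ ((2 ℕ.+ m) ℕ.+ (3 ℕ.+ m)) (charPattern (pathPlus (2 ℕ.+ m) (cycleE m))) ≈ U (suc ((2 ℕ.+ m) ℕ.+ (3 ℕ.+ m)))
  detᴾ-pathPlusCycle m = begin
    detᴾ ((2 ℕ.+ m) ℕ.+ (3 ℕ.+ m)) (charPattern (pathPlus (2 ℕ.+ m) (cycleE m)))
      ≈⟨ detᴾ-pathPlus (2 ℕ.+ m) (3 ℕ.+ m) (cycleE m) ⟩
    U (3 ℕ.+ m) * detᴾ (3 ℕ.+ m) (cycleChar m)
      ≈⟨ *-congˡ (detᴾ-cycle m) ⟩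
    U (3 ℕ.+ m) * (U (4 ℕ.+ m) - U (2 ℕ.+ m))
      ≈⟨ lemma (U (3 ℕ.+ m)) (U (4 ℕ.+ m)) (U (2 ℕ.+ m)) ⟩
    U (3 ℕ.+ m) * U (4 ℕ.+ m) - U (2 ℕ.+ m) * U (3 ℕ.+ m)
      ≈⟨ U-+ (2 ℕ.+ m) (3 ℕ.+ m) ⟨
    U (suc ((2 ℕ.+ m) ℕ.+ (3 ℕ.+ m)))
      ∎
    where
    lemma : ∀ a b c → a * (b - c) ≈ a * b - c * a
    lemma = solve 3 (λ a b c → a :* (b :- c) := a :* b :- c :* a) ≈-refl

  -- Characteristic polynomials of mixed graphs

  -- The diagonal of x I − A is a local with-definition of charPoly; naming the matrix lets `with`
  -- reach it (the witness is found by unification).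
  charMatrix : ∀ {n} (A : Matrix ℤi n) → Σ (Matrix Poly n) λ M → charPoly A ≡ det M
  charMatrix A = _ , refl

  xδ-diag : ∀ i → xδ i i ≡ X
  xδ-diag zero    = refl
  xδ-diag (suc i) = xδ-diag i

  xδ-off : ∀ i c → i ≢ c → xδ i c ≡ 0#
  xδ-off zero    zero    i≢c = ⊥-elim (i≢c refl)
  xδ-off zero    (suc c) i≢c = refl
  xδ-off (suc i) zero    i≢c = refl
  xδ-off (suc i) (suc c) i≢c = xδ-off i c (i≢c ∘ cong suc)

  opaque
    unfolding detᴾ _+ᴾ_ -ᴾ_

    charPoly≈detᴾ : ∀ {n} (G : MixedGraph n) E → (∀ a b → rel G a b ≡ E (toℕ a) (toℕ b)) →
                    charPoly (H G) ≈ detᴾ n (charPattern E)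
    charPoly≈detᴾ {n} G E rel≡E = ≈-trans (≈-reflexive (proj₂ (charMatrix (H G)))) (det-cong entry)
      where
      entry : ∀ a b → proj₁ (charMatrix (H G)) a b ≈ mat n (charPattern E) a b
      entry a b rewrite rel≡E a b with toℕ a ℕ.≟ toℕ b
      ... | yes a≡b = ≈-reflexive (cong (_p+ (p- const (entryH (E (toℕ a) (toℕ b)))))
                                      (sym (trans (cong (xδ (toℕ a)) (sym a≡b)) (xδ-diag (toℕ a)))))
      ... | no  a≢b = ≈-reflexive (cong (_p+ (p- const (entryH (E (toℕ a) (toℕ b)))))
                                      (sym (xδ-off (toℕ a) (toℕ b) a≢b)))

  charPoly-path : ∀ n → charPoly (H (P n)) ≈ U (suc n)
  charPoly-path n = ≈-trans (charPoly≈detᴾ (P n) pathE pathRel≡pathE) (detᴾ-path n)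

  pathPlusCycle-cospectral : ∀ m {N} (G : MixedGraph N) → N ≡ (2 ℕ.+ m) ℕ.+ (3 ℕ.+ m) →
    (∀ a b → rel G a b ≡ pathPlus (2 ℕ.+ m) (cycleE m) (toℕ a) (toℕ b)) → SameSpec G (P N)
  pathPlusCycle-cospectral m {N} G N≡ rel≡ = coeff $ begin
    charPoly (H G)
      ≈⟨ charPoly≈detᴾ G E rel≡ ⟩
    detᴾ N (charPattern E)
      ≈⟨ ≈-reflexive (cong (λ n → detᴾ n (charPattern E)) N≡) ⟩
    detᴾ ((2 ℕ.+ m) ℕ.+ (3 ℕ.+ m)) (charPattern E)
      ≈⟨ detᴾ-pathPlusCycle m ⟩
    U (suc ((2 ℕ.+ m) ℕ.+ (3 ℕ.+ m)))
      ≈⟨ ≈-reflexive (cong (U ∘ suc) N≡) ⟨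
    U (suc N)
      ≈⟨ charPoly-path N ⟨
    charPoly (H (P N))
      ∎
    where
    E = pathPlus (2 ℕ.+ m) (cycleE m)

open CharacteristicPolynomials using (pathPlusCycle-cospectral)

open import Data.Nat using (_+_; _*_; _≤_)
open import Data.Nat.Tactic.RingSolver using (solve-∀)
open import Data.Bool using (Bool; true; false)
open import Function.Bundles using (Inverse)

patternGraph : ∀ n E → Loopless E → Consistent E → MixedGraph n
patternGraph n E E-loopless E-consistent = record
  { rel        = λ a b → E (toℕ a) (toℕ b)
  ; loopless   = λ a → E-loopless (toℕ a)
  ; consistent = λ a b → E-consistent (toℕ a) (toℕ b) }

unit-product-nonzero : ∀ d d′ → 𝟘 ≢ (val (inv d) ⊗ 𝟙) ⊗ val d′
unit-product-nonzero u1  u1  ()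
unit-product-nonzero u1  u-1 ()
unit-product-nonzero u1  ui  ()
unit-product-nonzero u1  u-i ()
unit-product-nonzero u-1 u1  ()
unit-product-nonzero u-1 u-1 ()
unit-product-nonzero u-1 ui  ()
unit-product-nonzero u-1 u-i ()
unit-product-nonzero ui  u1  ()
unit-product-nonzero ui  u-1 ()
unit-product-nonzero ui  ui  ()
unit-product-nonzero ui  u-i ()
unit-product-nonzero u-i u1  ()
unit-product-nonzero u-i u-1 ()
unit-product-nonzero u-i ui  ()
unit-product-nonzero u-i u-i ()

switching-keeps-edges : ∀ {n} (Y Z : MixedGraph n) → SwitchingEquiv Y Z → ∀ a b → rel Z a b ≡ undir → rel Y a b ≢ none
switching-keeps-edges Y Z (D , H≡) a b Z-edge Y-none = unit-product-nonzero (D a) (D b) (begin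
  𝟘                                              ≡⟨ cong entryH Y-none ⟨
  H Y a b                                        ≡⟨ H≡ a b ⟩
  (val (inv (D a)) ⊗ H Z a b) ⊗ val (D b)        ≡⟨ cong (λ e → (val (inv (D a)) ⊗ entryH e) ⊗ val (D b)) Z-edge ⟩
  (val (inv (D a)) ⊗ 𝟙) ⊗ val (D b)              ∎)
  where open ≡-Reasoning

path-edge : ∀ {n} (i : Fin n) → rel (P (suc n)) (inject₁ i) (suc i) ≡ undir
path-edge i = trans (pathRel≡pathE (inject₁ i) (suc i))
                    (trans (cong (λ k → pathE k (suc (toℕ i))) (Fin.toℕ-inject₁ i)) (pathE-next (toℕ i)))

constant-along-path : ∀ {A : Set} {n} (f : Fin (suc n) → A) → (∀ (i : Fin n) → f (inject₁ i) ≡ f (suc i)) →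
                      ∀ u → f u ≡ f zero
constant-along-path {n = zero}  f step zero    = refl
constant-along-path {n = suc n} f step zero    = refl
constant-along-path {n = suc n} f step (suc u) =
  trans (constant-along-path (f ∘ suc) (λ i → step (suc i)) u) (sym (step zero))

disconnected-not-path-like : ∀ {n} (Y : MixedGraph n) (side : Fin n → Bool) →
  (∀ a b → rel Y a b ≢ none → side a ≡ side b) → ∀ a b → side a ≢ side b →
  ¬ Σ (MixedGraph n) (λ Z → SwitchingEquiv Y Z × Isomorphic Z (P n))
disconnected-not-path-like {suc n} Y side respects a b a≁b (Z , Y~Z , σ , iso) =
  a≁b (trans (sides-agree a) (sym (sides-agree b)))
  where
  open Inverse σ using (to; from; strictlyInverseˡ; strictlyInverseʳ)
  step : ∀ (i : Fin n) → side (from (inject₁ i)) ≡ side (from (suc i))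
  step i = respects _ _ (switching-keeps-edges Y Z Y~Z _ _ (begin
      rel Z (from (inject₁ i)) (from (suc i))            ≡⟨ iso _ _ ⟨
      rel (P (suc n)) (to (from (inject₁ i))) (to (from (suc i)))
                                                         ≡⟨ cong₂ (rel (P (suc n))) (strictlyInverseˡ _) (strictlyInverseˡ _) ⟩
      rel (P (suc n)) (inject₁ i) (suc i)                ≡⟨ path-edge i ⟩
      undir                                              ∎))
    where open ≡-Reasoning
  sides-agree : ∀ a → side a ≡ side (from zero)
  sides-agree a = trans (cong side (sym (strictlyInverseʳ a))) (constant-along-path (side ∘ from) step (to a))

true≢false : true ≢ false
true≢false ()

n<ᵇn : ∀ n → (n <ᵇ n) ≡ false
n<ᵇn zero    = refl
n<ᵇn (suc n) = n<ᵇn n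

pathPlusCycle : ∀ m → MixedGraph ((2 + m) + (3 + m))
pathPlusCycle m = patternGraph ((2 + m) + (3 + m)) (pathPlus (2 + m) (cycleE m))
  (pathPlus-loopless (2 + m) (cycleE m) (cycleE-loopless m)) (pathPlus-consistent (2 + m) (cycleE m) (cycleE-consistent m))

pathPlusCycle-not-DHS : ∀ m → ¬ DHS (P ((2 + m) + (3 + m)))
pathPlusCycle-not-DHS m dhs =
  disconnected-not-path-like (pathPlusCycle m) onPath (λ a b → pathPlus-no-crossing (2 + m) (cycleE m) (toℕ a) (toℕ b))
    zero firstOnCycle zero≁firstOnCycle
    (dhs (pathPlusCycle m) (pathPlusCycle-cospectral m (pathPlusCycle m) refl (λ _ _ → refl)))
  where
  onPath : Fin ((2 + m) + (3 + m)) → Bool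
  onPath a = toℕ a <ᵇ (2 + m)
  firstOnCycle : Fin ((2 + m) + (3 + m))
  firstOnCycle = (2 + m) ↑ʳ zero
  firstOnCycle-off : onPath firstOnCycle ≡ false
  firstOnCycle-off =
    trans (cong (_<ᵇ (2 + m)) (trans (Fin.toℕ-↑ʳ (2 + m) zero) (ℕ.+-identityʳ (2 + m)))) (n<ᵇn (2 + m))
  zero≁firstOnCycle : onPath zero ≢ onPath firstOnCycle
  zero≁firstOnCycle eq = true≢false (trans eq firstOnCycle-off)

theorem3p16 : (k : ℕ) → 1 ≤ k → ¬ DHS (P (4 * k + 1))
theorem3p16 (suc k) _ = subst (λ N → ¬ DHS (P N)) (sym (size k)) (pathPlusCycle-not-DHS (k + k))
  where
  size : ∀ k → 4 * suc k + 1 ≡ (2 + (k + k)) + (3 + (k + k))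
  size = solve-∀
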